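{- There exists a regressive set $A$ which has a total computable regressing function, but which has no regressing function that is both total and special.
   Context: An infinite set $A$ is regressive if $A=\{a_0,a_1,\dots\}$ with the $a_i$ distinct and there is a partial computable function $\varphi$ with $\varphi(a_{n+1})=a_n$ for all $n\ge 0$ and $\varphi(a_0)=a_0$; such $\varphi$ is a regressing function for $A$. For a function $f$ and $a\in\mathrm{Dom}(f)$, let $\hat f(a)=\{x:\exists n\ f^n(a)=x\}$. A regressing function $f$ for $A=\{a_0,a_1,\dots\}$ is special if $a_0\in\hat f(a)$ for all $a\in\mathrm{Dom}(f)$. -}

module Defs where

open import Data.Nat using (ℕ; zero; suc; _<_)
open import Data.Fin using (Fin)
open import Data.Vec using (Vec; []; _∷_; lookup)
open import Data.Product using (Σ; ∃; _×_; _,_)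
open import Relation.Binary.PropositionalEquality using (_≡_)

data PR : ℕ → Set where
  Z    : ∀ {n} → PR n
  S    : PR 1
  P    : ∀ {n} → Fin n → PR n
  C    : ∀ {m n} → PR m → Vec (PR n) m → PR n
  Rec  : ∀ {n} → PR n → PR (suc (suc n)) → PR (suc n)
  Mu   : ∀ {n} → PR (suc n) → PR n

data Eval : ∀ {n} → PR n → Vec ℕ n → ℕ → Set
data EvalAll : ∀ {m n} → Vec (PR n) m → Vec ℕ n → Vec ℕ m → Set

data Eval where
  evZ   : ∀ {n} {xs : Vec ℕ n} → Eval Z xs 0
  evS   : ∀ {x} → Eval S (x ∷ []) (suc x)
  evP   : ∀ {n} {xs : Vec ℕ n} (i : Fin n) → Eval (P i) xs (lookup xs i)
  evC   : ∀ {m n} {f : PR m} {gs : Vec (PR n)  m} {xs ys y} →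
          EvalAll gs xs ys → Eval f ys y → Eval (C f gs) xs y
  evR0  : ∀ {n} {f : PR n} {g : PR (suc (suc n))} {xs y} →
          Eval f xs y → Eval (Rec f g) (0 ∷ xs) y
  evRS  : ∀ {n} {f : PR n} {g : PR (suc (suc n))} {xs k z y} →
          Eval (Rec f g) (k ∷ xs) z → Eval g (k ∷ z ∷ xs) y →
          Eval (Rec f g) (suc k ∷ xs) y
  evMu  : ∀ {n} {f : PR (suc n)} {xs y} →
          Eval f (y ∷ xs) 0 →
          (∀ z → z < y → ∃ λ v → Eval f (z ∷ xs) (suc v)) →
          Eval (Mu f) xs y

data EvalAll where
  ev[]  : ∀ {n} {xs : Vec ℕ n} → EvalAll [] xs []
  ev∷   : ∀ {m n} {g : PR n} {gs : Vec (PR n) m} {xs y ys} →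
          Eval g xs y → EvalAll gs xs ys → EvalAll (g ∷ gs) xs (y ∷ ys)

_⟨_⟩≡_ : PR 1 → ℕ → ℕ → Set
φ ⟨ x ⟩≡ y = Eval φ (x ∷ []) y

Dom : PR 1 → ℕ → Set
Dom φ x = ∃ λ y → φ ⟨ x ⟩≡ y

Total : PR 1 → Set
Total φ = ∀ x → Dom φ x

data Iter (φ : PR 1) : ℕ → ℕ → ℕ → Set where
  it0 : ∀ {x} → Iter φ 0 x x
  itS : ∀ {n x z y} → φ ⟨ x ⟩≡ z → Iter φ n z y → Iter φ (suc n) x y

Hat : PR 1 → ℕ → ℕ → Set
Hat φ a x = ∃ λ n → Iter φ n a x

IsEnumOf : (ℕ → Set) → (ℕ → ℕ) → Set
IsEnumOf A a =
  (∀ m n → a m ≡ a n → m ≡ n) ×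
  (∀ x → (A x → ∃ λ n → a n ≡ x) × ((∃ λ n → a n ≡ x) → A x))

RegressingFor : PR 1 → (ℕ → Set) → (ℕ → ℕ) → Set
RegressingFor φ A a =
  IsEnumOf A a × (∀ n → φ ⟨ a (suc n) ⟩≡ a n) × (φ ⟨ a 0 ⟩≡ a 0)

Regressive : (ℕ → Set) → Set
Regressive A = Σ (PR 1) λ φ → Σ (ℕ → ℕ) λ a → RegressingFor φ A a

Special : PR 1 → (ℕ → ℕ) → Set
Special φ a = ∀ x → Dom φ x → Hat φ x (a 0)

{-# OPTIONS --safe #-}
-- For every code e two candidates w₁ = node e 0 0 and w₂ = node e 1 0 are reserved.  With
-- growing fuel we search the φₑ-orbit of each candidate for the other, until both searches have
-- either found it or reached a fixed point; e acts at the first stage T where this is so, which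
-- is decidable.  If the orbit of one candidate reaches the other, only the candidate it started
-- from is put into A; otherwise both are.  A is listed in blocks, one per pair (e , T), and a
-- total computable g steps back through the list.  If φₑ were a total special regressing
-- function for A, every orbit would reach the fixed point a 0, so e acts.  But A is closed
-- under φₑ, which excludes the first outcome, and along a regressing enumeration the orbit of
-- the later candidate passes through the earlier one before it reaches a fixed point, which
-- excludes the second.  Running the searches needs a universal function for the codes PR 1;
-- it is given by a small-step machine that is itself primitive recursive.
module Submission where

open import Defs
open import Data.Nat using (ℕ; zero; suc; _+_; _∸_; _≤_; _<_; z≤n; s≤s; pred; _⊔_; _<?_; _≤?_)
open import Data.Nat.Properties
open import Data.Fin using (Fin; toℕ) renaming (zero to fz; suc to fs)
open import Data.Vec using (Vec; []; _∷_; lookup; toList)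
open import Data.List using (List; _++_) renaming ([] to []ᴸ; _∷_ to _∷ᴸ_)
open import Data.List.Properties using (++-assoc; ++-identityʳ)
open import Data.Product using (Σ; ∃; _×_; _,_; proj₁; proj₂)
open import Data.Sum using (_⊎_; inj₁; inj₂)
open import Data.Empty using (⊥; ⊥-elim)
open import Function using (_∘_; case_of_)
open import Relation.Nullary using (¬_; Dec; yes; no)
open import Relation.Binary.Definitions using (tri<; tri≈; tri>)
open import Relation.Binary.PropositionalEquality hiding ([_])

mutual
  eval-functional : ∀ {n} {f : PR n} {xs y y'} → Eval f xs y → Eval f xs y' → y ≡ y'
  eval-functional evZ evZ = refl
  eval-functional evS evS = refl
  eval-functional (evP i) (evP .i) = refl
  eval-functional (evC a e) (evC a' e') with evalAll-functional a a'
  ... | refl = eval-functional e e'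
  eval-functional (evR0 e) (evR0 e') = eval-functional e e'
  eval-functional (evRS e g) (evRS e' g') with eval-functional e e'
  ... | refl = eval-functional g g'
  eval-functional (evMu {y = y} e h) (evMu {y = y'} e' h') with <-cmp y y'
  ... | tri≈ _ y≡y' _ = y≡y'
  ... | tri< y<y' _ _ = case eval-functional e (proj₂ (h' y y<y')) of λ ()
  ... | tri> _ _ y'<y = case eval-functional e' (proj₂ (h y' y'<y)) of λ ()

  evalAll-functional : ∀ {m n} {gs : Vec (PR n) m} {xs ys ys'} →
                       EvalAll gs xs ys → EvalAll gs xs ys' → ys ≡ ys'
  evalAll-functional ev[] ev[] = refl
  evalAll-functional (ev∷ e a) (ev∷ e' a') = cong₂ _∷_ (eval-functional e e') (evalAll-functional a a')

-- The semantics is kept as an Agda function, so that most correctness proofs below are refl.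
record Computable (n : ℕ) : Set where
  constructor mkC
  field
    code  : PR n
    sem   : Vec ℕ n → ℕ
    evals : ∀ xs → Eval code xs (sem xs)
open Computable public

withSem : ∀ {n} (c : Computable n) (f : Vec ℕ n → ℕ) → (∀ xs → sem c xs ≡ f xs) → Computable n
withSem c f eq = mkC (code c) f (λ xs → subst (Eval (code c) xs) (eq xs) (evals c xs))

zC : ∀ {n} → Computable n
zC = mkC Z (λ _ → 0) (λ _ → evZ)

sC : Computable 1
sC = mkC S (λ { (x ∷ []) → suc x }) (λ { (x ∷ []) → evS })

πC : ∀ {n} → Fin n → Computable n
πC i = mkC (P i) (λ xs → lookup xs i) (λ xs → evP i)

codes : ∀ {m n} → Vec (Computable n) m → Vec (PR n) m
codes [] = []
codes (g ∷ gs) = code g ∷ codes gs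

sems : ∀ {m n} → Vec (Computable n) m → Vec ℕ n → Vec ℕ m
sems [] xs = []
sems (g ∷ gs) xs = sem g xs ∷ sems gs xs

evalsAll : ∀ {m n} (gs : Vec (Computable n) m) xs → EvalAll (codes gs) xs (sems gs xs)
evalsAll [] xs = ev[]
evalsAll (g ∷ gs) xs = ev∷ (evals g xs) (evalsAll gs xs)

_∘C_ : ∀ {m n} → Computable m → Vec (Computable n) m → Computable n
f ∘C gs = mkC (C (code f) (codes gs)) (λ xs → sem f (sems gs xs))
              (λ xs → evC (evalsAll gs xs) (evals f (sems gs xs)))

primRec : ∀ {n} → (Vec ℕ n → ℕ) → (Vec ℕ (suc (suc n)) → ℕ) → ℕ → Vec ℕ n → ℕ
primRec f g zero xs = f xs
primRec f g (suc k) xs = g (k ∷ primRec f g k xs ∷ xs)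

primRec-evals : ∀ {n} (f : Computable n) (g : Computable (suc (suc n))) k xs →
                Eval (Rec (code f) (code g)) (k ∷ xs) (primRec (sem f) (sem g) k xs)
primRec-evals f g zero xs = evR0 (evals f xs)
primRec-evals f g (suc k) xs = evRS (primRec-evals f g k xs) (evals g _)

recC : ∀ {n} → Computable n → Computable (suc (suc n)) → Computable (suc n)
recC f g = mkC (Rec (code f) (code g)) (λ { (k ∷ xs) → primRec (sem f) (sem g) k xs })
               (λ { (k ∷ xs) → primRec-evals f g k xs })

recC-solving : ∀ {n} (f : Computable n) (g : Computable (suc (suc n))) (h : ℕ → Vec ℕ n → ℕ) →
               (∀ xs → sem f xs ≡ h 0 xs) → (∀ k xs → sem g (k ∷ h k xs ∷ xs) ≡ h (suc k) xs) →
               Computable (suc n)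
recC-solving f g h base step = withSem (recC f g) (λ { (k ∷ xs) → h k xs }) (λ { (k ∷ xs) → solves k xs })
  where
    solves : ∀ k xs → primRec (sem f) (sem g) k xs ≡ h k xs
    solves zero xs = base xs
    solves (suc k) xs = trans (cong (λ z → sem g (k ∷ z ∷ xs)) (solves k xs)) (step k xs)

positive : ∀ {k} → 0 < k → ∃ λ v → k ≡ suc v
positive {suc k} _ = k , refl

ifz : ℕ → ℕ → ℕ → ℕ
ifz zero a b = a
ifz (suc _) a b = b

-- least≤ p B is the least k ≤ B with p k ≡ 0, provided there is one.
least≤ : (ℕ → ℕ) → ℕ → ℕ
least≤ p zero = zero
least≤ p (suc B) = ifz (p 0) 0 (suc (least≤ (λ z → p (suc z)) B))

least≤-root : ∀ (p : ℕ → ℕ) (B k : ℕ) → p k ≡ 0 → k ≤ B → p (least≤ p B) ≡ 0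
least≤-root p zero zero pk≡0 _ = pk≡0
least≤-root p (suc B) k pk≡0 k≤B with p 0 in p0
... | zero = p0
least≤-root p (suc B) zero pk≡0 k≤B | suc _ = case trans (sym p0) pk≡0 of λ ()
least≤-root p (suc B) (suc k) pk≡0 (s≤s k≤B) | suc _ = least≤-root (λ z → p (suc z)) B k pk≡0 k≤B

least≤-≤ : ∀ (p : ℕ → ℕ) (B k : ℕ) → p k ≡ 0 → k ≤ B → least≤ p B ≤ k
least≤-≤ p zero zero pk≡0 _ = z≤n
least≤-≤ p (suc B) k pk≡0 k≤B with p 0 in p0
... | zero = z≤n
least≤-≤ p (suc B) zero pk≡0 k≤B | suc _ = case trans (sym p0) pk≡0 of λ ()
least≤-≤ p (suc B) (suc k) pk≡0 (s≤s k≤B) | suc _ = s≤s (least≤-≤ (λ z → p (suc z)) B k pk≡0 k≤B)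

least≤-minimal : ∀ (p : ℕ → ℕ) (B z : ℕ) → z < least≤ p B → ∃ λ v → p z ≡ suc v
least≤-minimal p zero z ()
least≤-minimal p (suc B) z z< with p 0 in p0
least≤-minimal p (suc B) z () | zero
least≤-minimal p (suc B) zero z< | suc v = v , p0
least≤-minimal p (suc B) (suc z) (s≤s z<) | suc v = least≤-minimal (λ z → p (suc z)) B z z<

least≤-unique : ∀ (p : ℕ → ℕ) (B k : ℕ) → p k ≡ 0 → k ≤ B →
                (∀ z → z < k → ∃ λ v → p z ≡ suc v) →
                least≤ p B ≡ k
least≤-unique p B k pk≡0 k≤B below with m≤n⇒m<n∨m≡n (least≤-≤ p B k pk≡0 k≤B)
... | inj₂ eq = eq
... | inj₁ lt = case trans (sym (least≤-root p B k pk≡0 k≤B)) (proj₂ (below _ lt)) of λ ()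

-- B only serves to describe the value as a bounded search; the code is plain Mu.
muC : ∀ {n} (f : Computable (suc n)) (B : Vec ℕ n → ℕ) → (∀ xs → sem f (B xs ∷ xs) ≡ 0) → Computable n
muC f B root = mkC (Mu (code f)) (λ xs → least≤ (λ y → sem f (y ∷ xs)) (B xs))
  (λ xs → evMu (subst (Eval (code f) _) (least≤-root (λ y → sem f (y ∷ xs)) (B xs) (B xs) (root xs) ≤-refl)
                      (evals f _))
               (λ z lt → let (v , fz≡) = least≤-minimal (λ y → sem f (y ∷ xs)) (B xs) z lt in
                          v , subst (Eval (code f) _) fz≡ (evals f _)))

pattern [_] a = a ∷ []
pattern [_⨾_] a b = a ∷ b ∷ []
pattern [_⨾_⨾_] a b c = a ∷ b ∷ c ∷ []
pattern [_⨾_⨾_⨾_] a b c d = a ∷ b ∷ c ∷ d ∷ []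
pattern [_⨾_⨾_⨾_⨾_] a b c d e = a ∷ b ∷ c ∷ d ∷ e ∷ []
pattern [_⨾_⨾_⨾_⨾_⨾_] a b c d e f = a ∷ b ∷ c ∷ d ∷ e ∷ f ∷ []

v0 : ∀ {n} → Fin (suc n)
v0 = fz
v1 : ∀ {n} → Fin (suc (suc n))
v1 = fs v0
v2 : ∀ {n} → Fin (suc (suc (suc n)))
v2 = fs v1
v3 : ∀ {n} → Fin (suc (suc (suc (suc n))))
v3 = fs v2
v4 : ∀ {n} → Fin (suc (suc (suc (suc (suc n)))))
v4 = fs v3

sucC : ∀ {n} → Computable n → Computable n
sucC c = sC ∘C [ c ]

addC : Computable 2
addC = recC-solving (πC v0) (sucC (πC v1)) (λ { x [ y ] → x + y }) (λ { [ y ] → refl }) (λ { k [ y ] → refl })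

predC : Computable 1
predC = withSem (recC zC (πC v0)) (λ { [ x ] → pred x }) (λ { [ zero ] → refl ; [ suc x ] → refl })

monusC : Computable 2
monusC = withSem (recC-solving (πC v0) (predC ∘C [ πC v1 ]) (λ { y [ x ] → x ∸ y })
                               (λ { [ x ] → refl }) (λ { y [ x ] → pred[m∸n]≡m∸[1+n] x y })
                  ∘C [ πC v1 ⨾ πC v0 ])
                 (λ { [ x ⨾ y ] → x ∸ y }) (λ { [ x ⨾ y ] → refl })

ifzC : Computable 3
ifzC = withSem (recC (πC v0) (πC v3)) (λ { [ c ⨾ a ⨾ b ] → ifz c a b })
               (λ { [ zero ⨾ a ⨾ b ] → refl ; [ suc c ⨾ a ⨾ b ] → refl })

litC : ∀ {n} → ℕ → Computable n
litC zero = zC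
litC (suc k) = sucC (litC k)

litC-sem : ∀ {n} k (xs : Vec ℕ n) → sem (litC k) xs ≡ k
litC-sem zero xs = refl
litC-sem (suc k) xs = cong suc (litC-sem k xs)

-- Cantor pairing

tri : ℕ → ℕ
tri zero = zero
tri (suc k) = suc k + tri k

triC : Computable 1
triC = withSem (recC-solving zC (addC ∘C [ sucC (πC v0) ⨾ πC v1 ]) (λ { k [] → tri k })
                             (λ { [] → refl }) (λ { k [] → refl }))
               (λ { [ k ] → tri k }) (λ { [ k ] → refl })

tri-mono-≤ : ∀ {a b} → a ≤ b → tri a ≤ tri b
tri-mono-≤ {zero} _ = z≤n
tri-mono-≤ {suc a} {suc b} (s≤s a≤b) = +-mono-≤ (s≤s a≤b) (tri-mono-≤ a≤b)

n≤tri[n] : ∀ n → n ≤ tri n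
n≤tri[n] zero = z≤n
n≤tri[n] (suc n) = m≤m+n (suc n) (tri n)

-- diagonal n is the w with tri w ≤ n < tri (suc w): the least w with suc n ∸ tri (suc w) ≡ 0.
below-next-diagonal : ℕ → ℕ → ℕ
below-next-diagonal n w = suc n ∸ tri (suc w)

diagonalC : Computable 1
diagonalC = muC (monusC ∘C [ sucC (πC v1) ⨾ triC ∘C [ sucC (πC v0) ] ]) (λ { [ n ] → n })
                (λ { [ n ] → m≤n⇒m∸n≡0 (n≤tri[n] (suc n)) })

pairC : Computable 2
pairC = addC ∘C [ triC ∘C [ addC ∘C [ πC v0 ⨾ πC v1 ] ] ⨾ πC v1 ]

-- Opaque, so that normalising codes of the universal machine below stays cheap.
opaque
  pairN : ℕ → ℕ → ℕ
  pairN x y = tri (x + y) + y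

  diagonal : ℕ → ℕ
  diagonal n = least≤ (below-next-diagonal n) n

  sndN : ℕ → ℕ
  sndN n = n ∸ tri (diagonal n)

  fstN : ℕ → ℕ
  fstN n = diagonal n ∸ sndN n

  diagonal-pair : ∀ x y → diagonal (pairN x y) ≡ x + y
  diagonal-pair x y = least≤-unique (below-next-diagonal (pairN x y)) (pairN x y) (x + y) root bound below
    where
      open ≤-Reasoning
      root : below-next-diagonal (pairN x y) (x + y) ≡ 0
      root = m≤n⇒m∸n≡0 (begin
        suc (tri (x + y) + y)     ≡⟨ sym (+-suc (tri (x + y)) y) ⟩
        tri (x + y) + suc y       ≤⟨ +-monoʳ-≤ (tri (x + y)) (s≤s (m≤n+m y x)) ⟩
        tri (x + y) + suc (x + y) ≡⟨ +-comm (tri (x + y)) _ ⟩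
        tri (suc (x + y))         ∎)
      bound : x + y ≤ pairN x y
      bound = ≤-trans (n≤tri[n] (x + y)) (m≤m+n _ y)
      below : ∀ z → z < x + y → ∃ λ v → below-next-diagonal (pairN x y) z ≡ suc v
      below z z< = positive (m<n⇒0<n∸m (s≤s (≤-trans (tri-mono-≤ z<) (m≤m+n _ y))))

  snd-pair : ∀ x y → sndN (pairN x y) ≡ y
  snd-pair x y rewrite diagonal-pair x y = m+n∸m≡n (tri (x + y)) y

  fst-pair : ∀ x y → fstN (pairN x y) ≡ x
  fst-pair x y rewrite snd-pair x y | diagonal-pair x y = m+n∸n≡m x y

  tri-diagonal-≤ : ∀ n → tri (diagonal n) ≤ n
  tri-diagonal-≤ n with diagonal n in eq
  ... | zero = z≤n
  ... | suc w with least≤-minimal (below-next-diagonal n) n w (subst (w <_) (sym eq) ≤-refl)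
  ...   | v , pos = ≤-pred (m∸n≢0⇒n<m (λ zero → case trans (sym pos) zero of λ ()))

  <-tri-suc-diagonal : ∀ n → n < tri (suc (diagonal n))
  <-tri-suc-diagonal n =
    m∸n≡0⇒m≤n (least≤-root (below-next-diagonal n) n n (m≤n⇒m∸n≡0 (n≤tri[n] (suc n))) ≤-refl)

  pair-fst-snd : ∀ n → pairN (fstN n) (sndN n) ≡ n
  pair-fst-snd n = trans (cong (λ z → tri z + sndN n) (m∸n+n≡m snd≤diag)) (m+[n∸m]≡n (tri-diagonal-≤ n))
    where
      snd≤diag : sndN n ≤ diagonal n
      snd≤diag = ≤-pred (+-cancelˡ-< (tri (diagonal n)) _ _
        (subst (_< tri (diagonal n) + suc (diagonal n)) (sym (m+[n∸m]≡n (tri-diagonal-≤ n)))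
          (subst (n <_) (+-comm (suc (diagonal n)) (tri (diagonal n))) (<-tri-suc-diagonal n))))

  pair-0-0 : pairN 0 0 ≡ 0
  pair-0-0 = refl

  pairC-sem : ∀ x y → sem pairC [ x ⨾ y ] ≡ pairN x y
  pairC-sem x y = refl

  diagonalC-sem : ∀ n → sem diagonalC [ n ] ≡ diagonal n
  diagonalC-sem n = refl

diagonalC′ : Computable 1
diagonalC′ = withSem diagonalC (λ { [ n ] → diagonal n }) (λ { [ n ] → diagonalC-sem n })

opaque
  unfolding sndN
  sndC-sem : ∀ n → sem (monusC ∘C [ πC v0 ⨾ triC ∘C [ diagonalC′ ] ]) [ n ] ≡ sndN n
  sndC-sem n = refl

sndC : Computable 1
sndC = withSem (monusC ∘C [ πC v0 ⨾ triC ∘C [ diagonalC′ ] ])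
               (λ { [ n ] → sndN n }) (λ { [ n ] → sndC-sem n })

opaque
  unfolding fstN
  fstC-sem : ∀ n → sem (monusC ∘C [ diagonalC′ ⨾ sndC ]) [ n ] ≡ fstN n
  fstC-sem n = refl

fstC : Computable 1
fstC = withSem (monusC ∘C [ diagonalC′ ⨾ sndC ]) (λ { [ n ] → fstN n }) (λ { [ n ] → fstC-sem n })

pairC′ : Computable 2
pairC′ = withSem pairC (λ { [ x ⨾ y ] → pairN x y }) (λ { [ x ⨾ y ] → pairC-sem x y })

pair-injective : ∀ {a b c d} → pairN a b ≡ pairN c d → a ≡ c × b ≡ d
pair-injective {a} {b} {c} {d} eq = trans (sym (fst-pair a b)) (trans (cong fstN eq) (fst-pair c d)) ,
                                    trans (sym (snd-pair a b)) (trans (cong sndN eq) (snd-pair c d))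

fst-0 : fstN 0 ≡ 0
fst-0 = subst (λ z → fstN z ≡ 0) pair-0-0 (fst-pair 0 0)

snd-0 : sndN 0 ≡ 0
snd-0 = subst (λ z → sndN z ≡ 0) pair-0-0 (snd-pair 0 0)

data Expr (n : ℕ) : Set where
  var : Fin n → Expr n
  lit : ℕ → Expr n
  _$_ : ∀ {m} → Computable m → Vec (Expr n) m → Expr n

infixr 5 _$_

mutual
  compile : ∀ {n} → Expr n → Computable n
  compile (var i) = πC i
  compile (lit k) = withSem (litC k) (λ _ → k) (litC-sem k)
  compile (f $ es) = f ∘C compileAll es

  compileAll : ∀ {n m} → Vec (Expr n) m → Vec (Computable n) m
  compileAll [] = []
  compileAll (e ∷ es) = compile e ∷ compileAll es

x0 : ∀ {n} → Expr (suc n)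
x0 = var v0
x1 : ∀ {n} → Expr (suc (suc n))
x1 = var v1
x2 : ∀ {n} → Expr (suc (suc (suc n)))
x2 = var v2
x3 : ∀ {n} → Expr (suc (suc (suc (suc n))))
x3 = var v3
x4 : ∀ {n} → Expr (suc (suc (suc (suc (suc n)))))
x4 = var v4
x5 : ∀ {n} → Expr (suc (suc (suc (suc (suc (suc n))))))
x5 = var (fs v4)

app₁ : ∀ {n} → Computable 1 → Expr n → Expr n
app₁ f a = f $ [ a ]
app₂ : ∀ {n} → Computable 2 → Expr n → Expr n → Expr n
app₂ f a b = f $ [ a ⨾ b ]

IFZ : ∀ {n} → Expr n → Expr n → Expr n → Expr n
IFZ c a b = ifzC $ [ c ⨾ a ⨾ b ]
PAIR MINUS : ∀ {n} → Expr n → Expr n → Expr n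
PAIR = app₂ pairC′
MINUS = app₂ monusC
FST SND PRED SUC : ∀ {n} → Expr n → Expr n
FST = app₁ fstC
SND = app₁ sndC
PRED = app₁ predC
SUC = app₁ sC

-- Lists of naturals: 0 is the empty list and suc (pairN x l) the list x ∷ l.

lcons : ℕ → ℕ → ℕ
lcons x l = suc (pairN x l)

headN tailN : ℕ → ℕ
headN l = fstN (pred l)
tailN l = sndN (pred l)

head-lcons : ∀ x l → headN (lcons x l) ≡ x
head-lcons = fst-pair

tail-lcons : ∀ x l → tailN (lcons x l) ≡ l
tail-lcons = snd-pair

tailsN : ℕ → ℕ → ℕ
tailsN zero l = l
tailsN (suc i) l = tailN (tailsN i l)

nthN : ℕ → ℕ → ℕ
nthN i l = headN (tailsN i l)

eqN : ℕ → ℕ → ℕ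
eqN a b = (a ∸ b) + (b ∸ a)

eqN-refl : ∀ k → eqN k k ≡ 0
eqN-refl k rewrite n∸n≡0 k = refl

eqN-< : ∀ {k n} → k < n → ∃ λ v → eqN k n ≡ suc v
eqN-< {k} {n} k<n rewrite m≤n⇒m∸n≡0 (<⇒≤ k<n) = positive (m<n⇒0<n∸m k<n)

eqN≡0⇒≡ : ∀ a b → eqN a b ≡ 0 → a ≡ b
eqN≡0⇒≡ a b eq = ≤-antisym (m∸n≡0⇒m≤n (m+n≡0⇒m≡0 (a ∸ b) eq))
                            (m∸n≡0⇒m≤n (m+n≡0⇒n≡0 (a ∸ b) eq))

eqN≡suc⇒≢ : ∀ a b v → eqN a b ≡ suc v → a ≢ b
eqN≡suc⇒≢ a b v eq refl = 0≢1+n (trans (sym (eqN-refl a)) eq)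

lconsC : Computable 2
lconsC = withSem (compile (SUC (PAIR x0 x1))) (λ { [ x ⨾ l ] → lcons x l }) (λ { [ x ⨾ l ] → refl })

headC tailC : Computable 1
headC = withSem (compile (FST (PRED x0))) (λ { [ l ] → headN l }) (λ { [ l ] → refl })
tailC = withSem (compile (SND (PRED x0))) (λ { [ l ] → tailN l }) (λ { [ l ] → refl })

tailsC : Computable 2
tailsC = recC-solving (πC v0) (tailC ∘C [ πC v1 ]) (λ { i [ l ] → tailsN i l })
                      (λ { [ l ] → refl }) (λ { i [ l ] → refl })

nthC : Computable 2
nthC = withSem (compile (app₁ headC (app₂ tailsC x0 x1))) (λ { [ i ⨾ l ] → nthN i l }) (λ { [ i ⨾ l ] → refl })

eqC : Computable 2
eqC = withSem (compile (app₂ addC (MINUS x0 x1) (MINUS x1 x0)))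
              (λ { [ a ⨾ b ] → eqN a b }) (λ { [ a ⨾ b ] → refl })

HEAD TAIL : ∀ {n} → Expr n → Expr n
HEAD = app₁ headC
TAIL = app₁ tailC
LCONS EQ : ∀ {n} → Expr n → Expr n → Expr n
LCONS = app₂ lconsC
EQ = app₂ eqC

encL : List ℕ → ℕ
encL []ᴸ = 0
encL (x ∷ᴸ l) = lcons x (encL l)

encV : ∀ {n} → Vec ℕ n → ℕ
encV xs = encL (toList xs)

tails-suc : ∀ j l → tailsN (suc j) l ≡ tailsN j (tailN l)
tails-suc zero l = refl
tails-suc (suc j) l = cong tailN (tails-suc j l)

nth-encV : ∀ {n} (xs : Vec ℕ n) (i : Fin n) → nthN (toℕ i) (encV xs) ≡ lookup xs i
nth-encV (x ∷ xs) fz = head-lcons x _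
nth-encV (x ∷ xs) (fs i) =
  trans (cong headN (trans (tails-suc (toℕ i) _) (cong (tailsN (toℕ i)) (tail-lcons x _)))) (nth-encV xs i)

-- A universal machine

mutual
  ⌜_⌝ : ∀ {n} → PR n → ℕ
  ⌜ Z ⌝ = pairN 0 0
  ⌜ S ⌝ = pairN 1 0
  ⌜ P i ⌝ = pairN 2 (toℕ i)
  ⌜ C f gs ⌝ = pairN 3 (pairN ⌜ f ⌝ (encL (revCodes gs)))
  ⌜ Rec f g ⌝ = pairN 4 (pairN ⌜ f ⌝ ⌜ g ⌝)
  ⌜ Mu f ⌝ = pairN 5 ⌜ f ⌝

  -- Reversed because the machine pushes the values of the arguments onto an accumulator.
  revCodes : ∀ {m n} → Vec (PR n) m → List ℕ
  revCodes [] = []ᴸ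
  revCodes (g ∷ gs) = revCodes gs ++ (⌜ g ⌝ ∷ᴸ []ᴸ)

-- A state either evaluates code c on the argument list xs, returns the value v, or has halted;
-- K is a stack of frames recording what to do with a returned value:
--   compFr f t xs acc : the argument codes t are still to run on xs, acc holds the values so far;
--   recFr g n k xs    : the recursion Rec _ g on (n ∷ xs) has reached k;
--   muFr f y xs       : the search Mu f on xs is testing y.
evalSt : ℕ → ℕ → ℕ → ℕ
evalSt c xs K = pairN 0 (pairN c (pairN xs K))
retSt : ℕ → ℕ → ℕ
retSt v K = pairN 1 (pairN v K)
haltSt : ℕ → ℕ
haltSt v = pairN 2 v

compFr recFr : ℕ → ℕ → ℕ → ℕ → ℕ
compFr f t xs acc = pairN 0 (pairN f (pairN t (pairN xs acc)))
recFr g n k xs = pairN 1 (pairN g (pairN n (pairN k xs)))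
muFr : ℕ → ℕ → ℕ → ℕ
muFr f y xs = pairN 2 (pairN f (pairN y xs))

evalStC : Computable 3
evalStC = withSem (compile (PAIR (lit 0) (PAIR x0 (PAIR x1 x2))))
                  (λ { [ c ⨾ xs ⨾ K ] → evalSt c xs K }) (λ { [ c ⨾ xs ⨾ K ] → refl })
retStC : Computable 2
retStC = withSem (compile (PAIR (lit 1) (PAIR x0 x1))) (λ { [ v ⨾ K ] → retSt v K }) (λ { [ v ⨾ K ] → refl })
haltStC : Computable 1
haltStC = withSem (compile (PAIR (lit 2) x0)) (λ { [ v ] → haltSt v }) (λ { [ v ] → refl })
compFrC recFrC : Computable 4
compFrC = withSem (compile (PAIR (lit 0) (PAIR x0 (PAIR x1 (PAIR x2 x3)))))
                  (λ { [ a ⨾ b ⨾ c ⨾ d ] → compFr a b c d }) (λ { [ a ⨾ b ⨾ c ⨾ d ] → refl })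
recFrC = withSem (compile (PAIR (lit 1) (PAIR x0 (PAIR x1 (PAIR x2 x3)))))
                 (λ { [ a ⨾ b ⨾ c ⨾ d ] → recFr a b c d }) (λ { [ a ⨾ b ⨾ c ⨾ d ] → refl })
muFrC : Computable 3
muFrC = withSem (compile (PAIR (lit 2) (PAIR x0 (PAIR x1 x2))))
                (λ { [ a ⨾ b ⨾ c ] → muFr a b c }) (λ { [ a ⨾ b ⨾ c ] → refl })

nextArg : ℕ → ℕ → ℕ → ℕ → ℕ → ℕ
nextArg f t xs acc K = ifz t (evalSt f acc K) (evalSt (headN t) xs (lcons (compFr f (tailN t) xs acc) K))

nextArgC : Computable 5
nextArgC = withSem
  (compile (IFZ x1 (evalStC $ [ x0 ⨾ x3 ⨾ x4 ])
                   (evalStC $ [ HEAD x1 ⨾ x2 ⨾ LCONS (compFrC $ [ x0 ⨾ TAIL x1 ⨾ x2 ⨾ x3 ]) x4 ])))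
  (λ { [ f ⨾ t ⨾ xs ⨾ acc ⨾ K ] → nextArg f t xs acc K }) (λ { [ f ⨾ t ⨾ xs ⨾ acc ⨾ K ] → refl })

stepEval : ℕ → ℕ → ℕ → ℕ
stepEval c xs K =
  ifz (fstN c) (retSt 0 K)
  (ifz (pred (fstN c)) (retSt (suc (headN xs)) K)
  (ifz (fstN c ∸ 2) (retSt (nthN (sndN c) xs) K)
  (ifz (fstN c ∸ 3) (nextArg (fstN (sndN c)) (sndN (sndN c)) xs 0 K)
  (ifz (fstN c ∸ 4) (evalSt (fstN (sndN c)) (tailN xs) (lcons (recFr (sndN (sndN c)) (headN xs) 0 (tailN xs)) K))
  (evalSt (sndN c) (lcons 0 xs) (lcons (muFr (sndN c) 0 xs) K))))))

stepEvalC : Computable 3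
stepEvalC = withSem
  (compile
    (IFZ (FST x0) (retStC $ [ lit 0 ⨾ x2 ])
    (IFZ (PRED (FST x0)) (retStC $ [ SUC (HEAD x1) ⨾ x2 ])
    (IFZ (MINUS (FST x0) (lit 2)) (retStC $ [ app₂ nthC (SND x0) x1 ⨾ x2 ])
    (IFZ (MINUS (FST x0) (lit 3)) (nextArgC $ [ FST (SND x0) ⨾ SND (SND x0) ⨾ x1 ⨾ lit 0 ⨾ x2 ])
    (IFZ (MINUS (FST x0) (lit 4))
         (evalStC $ [ FST (SND x0) ⨾ TAIL x1 ⨾ LCONS (recFrC $ [ SND (SND x0) ⨾ HEAD x1 ⨾ lit 0 ⨾ TAIL x1 ]) x2 ])
    (evalStC $ [ SND x0 ⨾ LCONS (lit 0) x1 ⨾ LCONS (muFrC $ [ SND x0 ⨾ lit 0 ⨾ x1 ]) x2 ])))))))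
  (λ { [ c ⨾ xs ⨾ K ] → stepEval c xs K }) (λ { [ c ⨾ xs ⨾ K ] → refl })

stepRecFr : ℕ → ℕ → ℕ → ℕ → ℕ → ℕ → ℕ
stepRecFr v g n k xs K = ifz (eqN k n) (retSt v K) (evalSt g (lcons k (lcons v xs)) (lcons (recFr g n (suc k) xs) K))

stepRecFrC : Computable 6
stepRecFrC = withSem
  (compile (IFZ (EQ x3 x2) (retStC $ [ x0 ⨾ x5 ])
                (evalStC $ [ x1 ⨾ LCONS x3 (LCONS x0 x4) ⨾ LCONS (recFrC $ [ x1 ⨾ x2 ⨾ SUC x3 ⨾ x4 ]) x5 ])))
  (λ { [ v ⨾ g ⨾ n ⨾ k ⨾ xs ⨾ K ] → stepRecFr v g n k xs K })
  (λ { [ v ⨾ g ⨾ n ⨾ k ⨾ xs ⨾ K ] → refl })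

stepMuFr : ℕ → ℕ → ℕ → ℕ → ℕ → ℕ
stepMuFr v f y xs K = ifz v (retSt y K) (evalSt f (lcons (suc y) xs) (lcons (muFr f (suc y) xs) K))

stepMuFrC : Computable 5
stepMuFrC = withSem
  (compile (IFZ x0 (retStC $ [ x2 ⨾ x4 ])
                   (evalStC $ [ x1 ⨾ LCONS (SUC x2) x3 ⨾ LCONS (muFrC $ [ x1 ⨾ SUC x2 ⨾ x3 ]) x4 ])))
  (λ { [ v ⨾ f ⨾ y ⨾ xs ⨾ K ] → stepMuFr v f y xs K }) (λ { [ v ⨾ f ⨾ y ⨾ xs ⨾ K ] → refl })

stepFrame : ℕ → ℕ → ℕ → ℕ
stepFrame v fr K =
  ifz (fstN fr)
      (nextArg (fstN (sndN fr)) (fstN (sndN (sndN fr))) (fstN (sndN (sndN (sndN fr))))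
               (lcons v (sndN (sndN (sndN (sndN fr))))) K)
  (ifz (pred (fstN fr))
       (stepRecFr v (fstN (sndN fr)) (fstN (sndN (sndN fr))) (fstN (sndN (sndN (sndN fr))))
                  (sndN (sndN (sndN (sndN fr)))) K)
       (stepMuFr v (fstN (sndN fr)) (fstN (sndN (sndN fr))) (sndN (sndN (sndN fr))) K))

stepFrameC : Computable 3
stepFrameC = withSem
  (compile
    (IFZ (FST x1)
         (nextArgC $ [ FST (SND x1) ⨾ FST (SND (SND x1)) ⨾ FST (SND (SND (SND x1)))
                     ⨾ LCONS x0 (SND (SND (SND (SND x1)))) ⨾ x2 ])
    (IFZ (PRED (FST x1))
         (stepRecFrC $ [ x0 ⨾ FST (SND x1) ⨾ FST (SND (SND x1)) ⨾ FST (SND (SND (SND x1)))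
                       ⨾ SND (SND (SND (SND x1))) ⨾ x2 ])
         (stepMuFrC $ [ x0 ⨾ FST (SND x1) ⨾ FST (SND (SND x1)) ⨾ SND (SND (SND x1)) ⨾ x2 ]))))
  (λ { [ v ⨾ fr ⨾ K ] → stepFrame v fr K }) (λ { [ v ⨾ fr ⨾ K ] → refl })

stepReturn : ℕ → ℕ
stepReturn r = ifz (sndN r) (haltSt (fstN r)) (stepFrame (fstN r) (headN (sndN r)) (tailN (sndN r)))

stepReturnC : Computable 1
stepReturnC = withSem
  (compile (IFZ (SND x0) (haltStC $ [ FST x0 ]) (stepFrameC $ [ FST x0 ⨾ HEAD (SND x0) ⨾ TAIL (SND x0) ])))
  (λ { [ r ] → stepReturn r }) (λ { [ r ] → refl })

step : ℕ → ℕ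
step st = ifz (fstN st) (stepEval (fstN (sndN st)) (fstN (sndN (sndN st))) (sndN (sndN (sndN st))))
          (ifz (pred (fstN st)) (stepReturn (sndN st)) st)

stepC : Computable 1
stepC = withSem
  (compile (IFZ (FST x0) (stepEvalC $ [ FST (SND x0) ⨾ FST (SND (SND x0)) ⨾ SND (SND (SND x0)) ])
                         (IFZ (PRED (FST x0)) (stepReturnC $ [ SND x0 ]) x0)))
  (λ { [ st ] → step st }) (λ { [ st ] → refl })

run : ℕ → ℕ → ℕ
run zero s = s
run (suc t) s = step (run t s)

runC : Computable 2
runC = recC-solving (πC v0) (stepC ∘C [ πC v1 ]) (λ { t [ s ] → run t s })
                    (λ { [ s ] → refl }) (λ { t [ s ] → refl })

output : ℕ → ℕ
output s = ifz (eqN (fstN s) 2) (suc (sndN s)) 0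

-- U c x t is suc y if the machine started on code c and input x halts with value y within t steps,
-- and 0 otherwise.
U : ℕ → ℕ → ℕ → ℕ
U c x t = output (run t (evalSt c (lcons x 0) 0))

UC : Computable 3
UC = withSem
  (compile (IFZ (EQ (FST final) (lit 2)) (SUC (SND final)) (lit 0)))
  (λ { [ c ⨾ x ⨾ t ] → U c x t }) (λ { [ c ⨾ x ⨾ t ] → refl })
  where
    final : Expr 3
    final = app₂ runC x2 (evalStC $ [ x0 ⨾ LCONS x1 (lit 0) ⨾ lit 0 ])

data _↝*_ : ℕ → ℕ → Set where
  done : ∀ {s} → s ↝* s
  more : ∀ {s s'} → step s ↝* s' → s ↝* s'

infix 4 _↝*_

↝*-trans : ∀ {a b c} → a ↝* b → b ↝* c → a ↝* c
↝*-trans done q = q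
↝*-trans (more p) q = more (↝*-trans p q)

steps-to : ∀ {s s' s''} → step s ≡ s' → s' ↝* s'' → s ↝* s''
steps-to eq r = more (subst (_↝* _) (sym eq) r)

↝*-ifz-zero : ∀ {c a b s} → c ≡ 0 → a ↝* s → ifz c a b ↝* s
↝*-ifz-zero refl r = r

↝*-ifz-suc : ∀ {c a b s v} → c ≡ suc v → b ↝* s → ifz c a b ↝* s
↝*-ifz-suc refl r = r

run-suc : ∀ n s → run (suc n) s ≡ run n (step s)
run-suc zero s = refl
run-suc (suc n) s = cong step (run-suc n s)

↝*⇒run : ∀ {s s'} → s ↝* s' → ∃ λ n → run n s ≡ s'
↝*⇒run done = 0 , refl
↝*⇒run (more {s} r) = let (n , eq) = ↝*⇒run r in suc n , trans (run-suc n s) eq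

step-evalSt : ∀ c xs K → step (evalSt c xs K) ≡ stepEval c xs K
step-evalSt c xs K
  rewrite fst-pair 0 (pairN c (pairN xs K)) | snd-pair 0 (pairN c (pairN xs K))
        | fst-pair c (pairN xs K) | snd-pair c (pairN xs K) | fst-pair xs K | snd-pair xs K = refl

step-Z : ∀ {n} xs K → step (evalSt ⌜ Z {n} ⌝ xs K) ≡ retSt 0 K
step-Z xs K rewrite step-evalSt (pairN 0 0) xs K | fst-pair 0 0 = refl

step-S : ∀ x K → step (evalSt ⌜ S ⌝ (lcons x 0) K) ≡ retSt (suc x) K
step-S x K rewrite step-evalSt (pairN 1 0) (lcons x 0) K | fst-pair 1 0 | head-lcons x 0 = refl

step-P : ∀ {n} (i : Fin n) xs K → step (evalSt ⌜ P i ⌝ xs K) ≡ retSt (nthN (toℕ i) xs) K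
step-P i xs K rewrite step-evalSt (pairN 2 (toℕ i)) xs K | fst-pair 2 (toℕ i) | snd-pair 2 (toℕ i) = refl

step-C : ∀ f r xs K → step (evalSt (pairN 3 (pairN f r)) xs K) ≡ nextArg f r xs 0 K
step-C f r xs K
  rewrite step-evalSt (pairN 3 (pairN f r)) xs K | fst-pair 3 (pairN f r) | snd-pair 3 (pairN f r)
        | fst-pair f r | snd-pair f r = refl

step-Rec : ∀ {n} (f : PR n) g k xs K →
           step (evalSt ⌜ Rec f g ⌝ (lcons k xs) K) ≡ evalSt ⌜ f ⌝ xs (lcons (recFr ⌜ g ⌝ k 0 xs) K)
step-Rec f g k xs K
  rewrite step-evalSt (pairN 4 (pairN ⌜ f ⌝ ⌜ g ⌝)) (lcons k xs) K
        | fst-pair 4 (pairN ⌜ f ⌝ ⌜ g ⌝) | snd-pair 4 (pairN ⌜ f ⌝ ⌜ g ⌝) | fst-pair ⌜ f ⌝ ⌜ g ⌝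
        | snd-pair ⌜ f ⌝ ⌜ g ⌝ | head-lcons k xs | tail-lcons k xs = refl

step-Mu : ∀ {n} (f : PR (suc n)) xs K →
          step (evalSt ⌜ Mu f ⌝ xs K) ≡ evalSt ⌜ f ⌝ (lcons 0 xs) (lcons (muFr ⌜ f ⌝ 0 xs) K)
step-Mu f xs K rewrite step-evalSt (pairN 5 ⌜ f ⌝) xs K | fst-pair 5 ⌜ f ⌝ | snd-pair 5 ⌜ f ⌝ = refl

step-retSt : ∀ v fr K → step (retSt v (lcons fr K)) ≡ stepFrame v fr K
step-retSt v fr K
  rewrite fst-pair 1 (pairN v (lcons fr K)) | snd-pair 1 (pairN v (lcons fr K))
        | fst-pair v (lcons fr K) | snd-pair v (lcons fr K) | head-lcons fr K | tail-lcons fr K = refl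

step-retSt-top : ∀ v → step (retSt v 0) ≡ haltSt v
step-retSt-top v rewrite fst-pair 1 (pairN v 0) | snd-pair 1 (pairN v 0) | fst-pair v 0 | snd-pair v 0 = refl

step-haltSt : ∀ v → step (haltSt v) ≡ haltSt v
step-haltSt v rewrite fst-pair 2 v = refl

step-compFr : ∀ v f t xs acc K → step (retSt v (lcons (compFr f t xs acc) K)) ≡ nextArg f t xs (lcons v acc) K
step-compFr v f t xs acc K
  rewrite step-retSt v (compFr f t xs acc) K
        | fst-pair 0 (pairN f (pairN t (pairN xs acc))) | snd-pair 0 (pairN f (pairN t (pairN xs acc)))
        | fst-pair f (pairN t (pairN xs acc)) | snd-pair f (pairN t (pairN xs acc))
        | fst-pair t (pairN xs acc) | snd-pair t (pairN xs acc) | fst-pair xs acc | snd-pair xs acc = refl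

step-recFr : ∀ v g n k xs K → step (retSt v (lcons (recFr g n k xs) K)) ≡ stepRecFr v g n k xs K
step-recFr v g n k xs K
  rewrite step-retSt v (recFr g n k xs) K
        | fst-pair 1 (pairN g (pairN n (pairN k xs))) | snd-pair 1 (pairN g (pairN n (pairN k xs)))
        | fst-pair g (pairN n (pairN k xs)) | snd-pair g (pairN n (pairN k xs))
        | fst-pair n (pairN k xs) | snd-pair n (pairN k xs) | fst-pair k xs | snd-pair k xs = refl

step-muFr : ∀ v f y xs K → step (retSt v (lcons (muFr f y xs) K)) ≡ stepMuFr v f y xs K
step-muFr v f y xs K
  rewrite step-retSt v (muFr f y xs) K
        | fst-pair 2 (pairN f (pairN y xs)) | snd-pair 2 (pairN f (pairN y xs))
        | fst-pair f (pairN y xs) | snd-pair f (pairN y xs) | fst-pair y xs | snd-pair y xs = refl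

nextArg-lcons : ∀ f g t xs acc K → nextArg f (lcons g t) xs acc K ≡ evalSt g xs (lcons (compFr f t xs acc) K)
nextArg-lcons f g t xs acc K rewrite head-lcons g t | tail-lcons g t = refl

mutual
  eval-runs : ∀ {n} {f : PR n} {xs y} → Eval f xs y → ∀ K → evalSt ⌜ f ⌝ (encV xs) K ↝* retSt y K
  eval-runs {n} evZ K = steps-to (step-Z {n} _ K) done
  eval-runs (evS {x}) K = steps-to (step-S x K) done
  eval-runs {xs = xs} (evP i) K =
    steps-to (step-P i _ K) (subst (λ v → retSt v K ↝* retSt (lookup xs i) K) (sym (nth-encV xs i)) done)
  eval-runs {f = C f gs} {xs = xs} (evC {ys = ys} args e) K =
    steps-to (step-C ⌜ f ⌝ _ (encV xs) K)
      (↝*-trans (subst (λ L → nextArg ⌜ f ⌝ (encL L) (encV xs) 0 K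
                                 ↝* nextArg ⌜ f ⌝ 0 (encV xs) (encL (toList ys ++ []ᴸ)) K)
                       (++-identityʳ (revCodes gs)) (args-run args ⌜ f ⌝ []ᴸ []ᴸ K))
                (subst (λ L → evalSt ⌜ f ⌝ (encL L) K ↝* _) (sym (++-identityʳ (toList ys))) (eval-runs e K)))
  eval-runs (evR0 {f = f} {g = g} {xs = xs} {y = y} e) K =
    steps-to (step-Rec f g 0 (encV xs) K)
      (↝*-trans (rec-runs {g = g} (evR0 e) z≤n K) (steps-to (step-recFr y ⌜ g ⌝ 0 0 (encV xs) K) done))
  eval-runs (evRS {f = f} {g = g} {xs = xs} {k = k} {y = y} r e) K =
    steps-to (step-Rec f g (suc k) (encV xs) K)
      (↝*-trans (rec-runs {g = g} (evRS r e) ≤-refl K)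
                (steps-to (step-recFr y ⌜ g ⌝ (suc k) (suc k) (encV xs) K)
                          (↝*-ifz-zero (eqN-refl (suc k)) done)))
  eval-runs (evMu {f = f} e below) K = steps-to (step-Mu f _ K) (mu-runs e below 0 _ refl K)

  rec-runs : ∀ {n} {f : PR n} {g xs j z} → Eval (Rec f g) (j ∷ xs) z → ∀ {k} → j ≤ k → ∀ K →
             evalSt ⌜ f ⌝ (encV xs) (lcons (recFr ⌜ g ⌝ k 0 (encV xs)) K)
               ↝* retSt z (lcons (recFr ⌜ g ⌝ k j (encV xs)) K)
  rec-runs (evR0 e) j≤k K = eval-runs e _
  rec-runs {g = g} {xs = xs} (evRS {k = j} {z = z} r e) {k} j<k K =
    let (v , j≠k) = eqN-< {j} {k} j<k in
    ↝*-trans (rec-runs r (≤-trans (n≤1+n j) j<k) K)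
             (steps-to (step-recFr z ⌜ g ⌝ k j (encV xs) K)
                       (↝*-ifz-suc j≠k (eval-runs e _)))

  mu-runs : ∀ {n} {f : PR (suc n)} {xs y} → Eval f (y ∷ xs) 0 →
            (∀ z → z < y → ∃ λ v → Eval f (z ∷ xs) (suc v)) →
            ∀ j d → j + d ≡ y → ∀ K →
            evalSt ⌜ f ⌝ (lcons j (encV xs)) (lcons (muFr ⌜ f ⌝ j (encV xs)) K) ↝* retSt y K
  mu-runs {f = f} {xs = xs} e below j zero j+0≡y K rewrite +-identityʳ j | j+0≡y =
    ↝*-trans (eval-runs e _) (steps-to (step-muFr 0 ⌜ f ⌝ _ (encV xs) K) done)
  mu-runs {f = f} {xs = xs} e below j (suc d) j+d≡y K =
    ↝*-trans (eval-runs (proj₂ (below j (subst (j <_) j+d≡y (m<m+n j (s≤s z≤n))))) _)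
             (steps-to (step-muFr _ ⌜ f ⌝ j (encV xs) K) (mu-runs e below (suc j) d (trans (sym (+-suc j d)) j+d≡y) K))

  args-run : ∀ {m n} {gs : Vec (PR n) m} {xs ys} → EvalAll gs xs ys → ∀ f T A K →
             nextArg f (encL (revCodes gs ++ T)) (encV xs) (encL A) K
               ↝* nextArg f (encL T) (encV xs) (encL (toList ys ++ A)) K
  args-run ev[] f T A K = done
  args-run {gs = g ∷ gs} {xs = xs} (ev∷ {y = y} e args) f T A K =
    subst (λ L → nextArg f (encL L) (encV xs) (encL A) K ↝* _) (sym (++-assoc (revCodes gs) (⌜ g ⌝ ∷ᴸ []ᴸ) T))
      (↝*-trans (args-run args f (⌜ g ⌝ ∷ᴸ T) A K)
        (subst (_↝* _) (sym (nextArg-lcons f ⌜ g ⌝ (encL T) (encV xs) _ K))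
          (↝*-trans (eval-runs e _) (steps-to (step-compFr y f (encL T) (encV xs) _ K) done))))

output-haltSt : ∀ v → output (haltSt v) ≡ suc v
output-haltSt v rewrite fst-pair 2 v | snd-pair 2 v = refl

output≡suc⇒haltSt : ∀ s v → output s ≡ suc v → s ≡ haltSt v
output≡suc⇒haltSt s v out with eqN (fstN s) 2 in eq
... | zero = trans (sym (pair-fst-snd s)) (cong₂ pairN (eqN≡0⇒≡ _ _ eq) (suc-injective out))

run-haltSt : ∀ n v → run n (haltSt v) ≡ haltSt v
run-haltSt zero v = refl
run-haltSt (suc n) v = trans (cong step (run-haltSt n v)) (step-haltSt v)

run-+ : ∀ a b s → run (a + b) s ≡ run a (run b s)
run-+ zero b s = refl
run-+ (suc a) b s = cong step (run-+ a b s)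

U-complete : ∀ {φ : PR 1} {x y} → φ ⟨ x ⟩≡ y → ∃ λ t → U ⌜ φ ⌝ x t ≡ suc y
U-complete {y = y} e =
  let (t , halts) = ↝*⇒run (↝*-trans (eval-runs e 0) (steps-to (step-retSt-top y) done)) in
  t , trans (cong output halts) (output-haltSt y)

U-mono : ∀ c x t t' v → U c x t ≡ suc v → t ≤ t' → U c x t' ≡ suc v
U-mono c x t t' v halted t≤t' = begin
  output (run t' s)                   ≡⟨ cong (λ n → output (run n s)) (sym (m∸n+n≡m t≤t')) ⟩
  output (run ((t' ∸ t) + t) s)       ≡⟨ cong output (run-+ (t' ∸ t) t s) ⟩
  output (run (t' ∸ t) (run t s))     ≡⟨ cong (output ∘ run (t' ∸ t)) (output≡suc⇒haltSt _ v halted) ⟩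
  output (run (t' ∸ t) (haltSt v))    ≡⟨ cong output (run-haltSt (t' ∸ t) v) ⟩
  output (haltSt v)                   ≡⟨ output-haltSt v ⟩
  suc v                               ∎
  where
    open ≡-Reasoning
    s = evalSt c (lcons x 0) 0

-- Searching an orbit of φₑ

-- One step of the search for y along the orbit of φₑ, each value computed with fuel t.  The state
-- pairN 0 c means "at c"; the search stops with result 1 (found y), 2 (reached a fixed point
-- other than y) or 3 (out of fuel).
orbitMove : ℕ → ℕ → ℕ → ℕ → ℕ
orbitMove e y t c =
  ifz (eqN c y) (pairN 1 0)
  (ifz (U e c t) (pairN 3 0)
  (ifz (eqN (pred (U e c t)) c) (pairN 2 0) (pairN 0 (pred (U e c t)))))

orbitMoveC : Computable 4
orbitMoveC = withSem
  (compile (IFZ (EQ x3 x1) (lit (pairN 1 0))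
           (IFZ (Uₑct) (lit (pairN 3 0))
           (IFZ (EQ (PRED Uₑct) x3) (lit (pairN 2 0)) (PAIR (lit 0) (PRED Uₑct))))))
  (λ { [ e ⨾ y ⨾ t ⨾ c ] → orbitMove e y t c }) (λ { [ e ⨾ y ⨾ t ⨾ c ] → refl })
  where
    Uₑct : Expr 4
    Uₑct = UC $ [ x0 ⨾ x3 ⨾ x2 ]

orbitStep : ℕ → ℕ → ℕ → ℕ → ℕ
orbitStep e y t st = ifz (fstN st) (orbitMove e y t (sndN st)) st

orbitStepC : Computable 4
orbitStepC = withSem (compile (IFZ (FST x3) (orbitMoveC $ [ x0 ⨾ x1 ⨾ x2 ⨾ SND x3 ]) x3))
                     (λ { [ e ⨾ y ⨾ t ⨾ st ] → orbitStep e y t st }) (λ { [ e ⨾ y ⨾ t ⨾ st ] → refl })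

orbitRun : ℕ → ℕ → ℕ → ℕ → ℕ → ℕ
orbitRun e y t zero st = st
orbitRun e y t (suc k) st = orbitStep e y t (orbitRun e y t k st)

orbitRunC : Computable 5
orbitRunC = recC-solving (πC v3) (orbitStepC ∘C [ πC v2 ⨾ πC v3 ⨾ πC v4 ⨾ πC v1 ])
                         (λ { k [ e ⨾ y ⨾ t ⨾ st ] → orbitRun e y t k st })
                         (λ { [ e ⨾ y ⨾ t ⨾ st ] → refl }) (λ { k [ e ⨾ y ⨾ t ⨾ st ] → refl })

orbitSearchE : Expr 4
orbitSearchE = FST (orbitRunC $ [ x3 ⨾ x0 ⨾ x2 ⨾ x3 ⨾ PAIR (lit 0) x1 ])

opaque
  orbitSearch : ℕ → ℕ → ℕ → ℕ → ℕ
  orbitSearch e x y t = fstN (orbitRun e y t t (pairN 0 x))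

  orbitSearch-def : ∀ e x y t → orbitSearch e x y t ≡ fstN (orbitRun e y t t (pairN 0 x))
  orbitSearch-def e x y t = refl

  orbitSearchC-sem : ∀ e x y t →
    sem (compile orbitSearchE) [ e ⨾ x ⨾ y ⨾ t ] ≡ orbitSearch e x y t
  orbitSearchC-sem e x y t = refl

orbitSearchC : Computable 4
orbitSearchC = withSem (compile orbitSearchE)
                       (λ { [ e ⨾ x ⨾ y ⨾ t ] → orbitSearch e x y t })
                       (λ { [ e ⨾ x ⨾ y ⨾ t ] → orbitSearchC-sem e x y t })

orbitStep-stopped : ∀ e y t st v → fstN st ≡ suc v → orbitStep e y t st ≡ st
orbitStep-stopped e y t st v stopped rewrite stopped = refl

orbitStep-at : ∀ e y t c → orbitStep e y t (pairN 0 c) ≡ orbitMove e y t c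
orbitStep-at e y t c rewrite fst-pair 0 c | snd-pair 0 c = refl

orbitRun-fixed : ∀ e y t k st → orbitStep e y t st ≡ st → orbitRun e y t k st ≡ st
orbitRun-fixed e y t zero st fixed = refl
orbitRun-fixed e y t (suc k) st fixed = trans (cong (orbitStep e y t) (orbitRun-fixed e y t k st fixed)) fixed

orbitRun-+ : ∀ e y t k m st → orbitRun e y t (k + m) st ≡ orbitRun e y t k (orbitRun e y t m st)
orbitRun-+ e y t zero m st = refl
orbitRun-+ e y t (suc k) m st = cong (orbitStep e y t) (orbitRun-+ e y t k m st)

orbitRun-stopped : ∀ e y t k st v → fstN (orbitRun e y t k st) ≡ suc v → fstN (orbitRun e y t (suc k) st) ≡ suc v
orbitRun-stopped e y t k st v stopped = trans (cong fstN (orbitStep-stopped e y t _ v stopped)) stopped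

orbitRun-moves : ∀ e y t k st c {st'} → orbitRun e y t k st ≡ pairN 0 c → orbitMove e y t c ≡ st' →
                 orbitRun e y t (suc k) st ≡ st'
orbitRun-moves e y t k st c at moved = trans (cong (orbitStep e y t) at) (trans (orbitStep-at e y t c) moved)

orbitRun-stops : ∀ e y t k st c r → orbitRun e y t k st ≡ pairN 0 c → orbitMove e y t c ≡ pairN r 0 →
                 fstN (orbitRun e y t (suc k) st) ≡ r
orbitRun-stops e y t k st c r at moved = trans (cong fstN (orbitRun-moves e y t k st c at moved)) (fst-pair r 0)

-- Only running out of fuel (result 3) depends on the fuel, by monotonicity of U.
orbitMove-fuel : ∀ e y t t' c → fstN (orbitMove e y t c) ≢ 3 → t ≤ t' → orbitMove e y t' c ≡ orbitMove e y t c
orbitMove-fuel e y t t' c not-out t≤t' with eqN c y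
... | zero = refl
... | suc _ with U e c t in halted
...   | zero = ⊥-elim (not-out (fst-pair 3 0))
...   | suc v rewrite U-mono e c t t' v halted t≤t' = refl

orbitStep-fuel : ∀ e y t t' st → fstN (orbitStep e y t st) ≢ 3 → t ≤ t' →
                 orbitStep e y t' st ≡ orbitStep e y t st
orbitStep-fuel e y t t' st not-out t≤t' with fstN st
... | zero = orbitMove-fuel e y t t' (sndN st) not-out t≤t'
... | suc _ = refl

orbitRun-fuel : ∀ e y t t' k st → fstN (orbitRun e y t k st) ≢ 3 → t ≤ t' →
                orbitRun e y t' k st ≡ orbitRun e y t k st
orbitRun-fuel e y t t' zero st not-out t≤t' = refl
orbitRun-fuel e y t t' (suc k) st not-out t≤t' =
  trans (cong (orbitStep e y t') (orbitRun-fuel e y t t' k st not-out′ t≤t')) (orbitStep-fuel e y t t' _ not-out t≤t')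
  where
    not-out′ : fstN (orbitRun e y t k st) ≢ 3
    not-out′ out = not-out (subst (λ z → fstN z ≡ 3) (sym (orbitStep-stopped e y t _ 2 out)) out)

orbitSearch-stable : ∀ e x y t t' v → orbitSearch e x y t ≡ suc v → suc v ≢ 3 → t ≤ t' →
                     orbitSearch e x y t' ≡ suc v
orbitSearch-stable e x y t t' v stopped not-out t≤t' = begin
  orbitSearch e x y t'                ≡⟨ orbitSearch-def e x y t' ⟩
  fstN (run′ t' st₀)                  ≡⟨ cong (λ k → fstN (run′ k st₀)) (sym (m∸n+n≡m t≤t')) ⟩
  fstN (run′ ((t' ∸ t) + t) st₀)      ≡⟨ cong fstN (orbitRun-+ e y t' (t' ∸ t) t st₀) ⟩
  fstN (run′ (t' ∸ t) (run′ t st₀))   ≡⟨ cong (fstN ∘ run′ (t' ∸ t)) same-run ⟩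
  fstN (run′ (t' ∸ t) st)             ≡⟨ cong fstN (orbitRun-fixed e y t' (t' ∸ t) st (orbitStep-stopped e y t' st v stopped′)) ⟩
  fstN st                             ≡⟨ stopped′ ⟩
  suc v                               ∎
  where
    open ≡-Reasoning
    run′ = orbitRun e y t'
    st₀ = pairN 0 x
    st = orbitRun e y t t st₀
    stopped′ : fstN st ≡ suc v
    stopped′ = trans (sym (orbitSearch-def e x y t)) stopped
    same-run : run′ t st₀ ≡ st
    same-run = orbitRun-fuel e y t t' t st₀ (λ out → not-out (trans (sym stopped′) out)) t≤t'

Settled : ℕ → Set
Settled r = r ≡ 1 ⊎ r ≡ 2

orbitSearch-settled : ∀ e x y t t' → Settled (orbitSearch e x y t) → t ≤ t' →
                      orbitSearch e x y t' ≡ orbitSearch e x y t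
orbitSearch-settled e x y t t' (inj₁ found) t≤t' =
  trans (orbitSearch-stable e x y t t' 0 found (λ ()) t≤t') (sym found)
orbitSearch-settled e x y t t' (inj₂ fixed) t≤t' =
  trans (orbitSearch-stable e x y t t' 1 fixed (λ ()) t≤t') (sym fixed)

Settled-≢1 : ∀ {r} → Settled r → r ≢ 1 → r ≡ 2
Settled-≢1 (inj₁ r≡1) r≢1 = ⊥-elim (r≢1 r≡1)
Settled-≢1 (inj₂ r≡2) _ = r≡2

Settled-mono : ∀ e x y t t' → Settled (orbitSearch e x y t) → t ≤ t' → Settled (orbitSearch e x y t')
Settled-mono e x y t t' settled t≤t' = subst Settled (sym (orbitSearch-settled e x y t t' settled t≤t')) settled

-- Numeric predicates below are 0 exactly when they hold.

node : ℕ → ℕ → ℕ → ℕ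
node e i t = pairN (suc (suc i)) (pairN e t)

nodeC : Computable 3
nodeC = withSem (compile (PAIR (SUC (SUC x1)) (PAIR x0 x2)))
                (λ { [ e ⨾ i ⨾ t ] → node e i t }) (λ { [ e ⨾ i ⨾ t ] → refl })

node-injective : ∀ {e i u e' i' u'} → node e i u ≡ node e' i' u' → e ≡ e' × i ≡ i' × u ≡ u'
node-injective eq with pair-injective eq
... | ssi≡ssi' , eu≡eu' with pair-injective eu≡eu'
...   | e≡e' , u≡u' = e≡e' , suc-injective (suc-injective ssi≡ssi') , u≡u'

settledN : ℕ → ℕ
settledN r = ifz r 1 (ifz (pred r) 0 (ifz (pred (pred r)) 0 1))

settledC : Computable 1
settledC = withSem (compile (IFZ x0 (lit 1) (IFZ (PRED x0) (lit 0) (IFZ (PRED (PRED x0)) (lit 0) (lit 1)))))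
                   (λ { [ r ] → settledN r }) (λ { [ r ] → refl })

settledN≡0⇒Settled : ∀ r → settledN r ≡ 0 → Settled r
settledN≡0⇒Settled (suc zero) _ = inj₁ refl
settledN≡0⇒Settled (suc (suc zero)) _ = inj₂ refl
settledN≡0⇒Settled zero ()
settledN≡0⇒Settled (suc (suc (suc r))) ()

Settled⇒settledN≡0 : ∀ {r} → Settled r → settledN r ≡ 0
Settled⇒settledN≡0 (inj₁ refl) = refl
Settled⇒settledN≡0 (inj₂ refl) = refl

search₁ search₂ : ℕ → ℕ → ℕ
search₁ e t = orbitSearch e (node e 0 0) (node e 1 0) t
search₂ e t = orbitSearch e (node e 1 0) (node e 0 0) t

search₁E search₂E : Expr 2
search₁E = orbitSearchC $ [ x0 ⨾ nodeC $ [ x0 ⨾ lit 0 ⨾ lit 0 ] ⨾ nodeC $ [ x0 ⨾ lit 1 ⨾ lit 0 ] ⨾ x1 ]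
search₂E = orbitSearchC $ [ x0 ⨾ nodeC $ [ x0 ⨾ lit 1 ⨾ lit 0 ] ⨾ nodeC $ [ x0 ⨾ lit 0 ⨾ lit 0 ] ⨾ x1 ]

doneE : Expr 2
doneE = app₂ addC (app₁ settledC search₁E) (app₁ settledC search₂E)

opaque
  doneN : ℕ → ℕ → ℕ
  doneN e t = settledN (search₁ e t) + settledN (search₂ e t)

  doneC-sem : ∀ e t → sem (compile doneE) [ e ⨾ t ] ≡ doneN e t
  doneC-sem e t = refl

  doneN≡0⇒Settled : ∀ e t → doneN e t ≡ 0 → Settled (search₁ e t) × Settled (search₂ e t)
  doneN≡0⇒Settled e t fin = settledN≡0⇒Settled _ (m+n≡0⇒m≡0 _ fin) ,
                             settledN≡0⇒Settled _ (m+n≡0⇒n≡0 (settledN (search₁ e t)) fin)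

  Settled⇒doneN≡0 : ∀ e t → Settled (search₁ e t) → Settled (search₂ e t) → doneN e t ≡ 0
  Settled⇒doneN≡0 e t settled₁ settled₂
    rewrite Settled⇒settledN≡0 settled₁ | Settled⇒settledN≡0 settled₂ = refl

  doneN-mono : ∀ e t t' → doneN e t ≡ 0 → t ≤ t' → doneN e t' ≡ 0
  doneN-mono e t t' fin t≤t'
    rewrite orbitSearch-settled e _ _ t t' (proj₁ (doneN≡0⇒Settled e t fin)) t≤t'
          | orbitSearch-settled e _ _ t t' (proj₂ (doneN≡0⇒Settled e t fin)) t≤t' = fin

doneC : Computable 2
doneC = withSem (compile doneE) (λ { [ e ⨾ t ] → doneN e t }) (λ { [ e ⨾ t ] → doneC-sem e t })

-- At fuel 0 the searches have not taken a single step.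
opaque
  unfolding orbitSearch doneN
  doneN-0 : ∀ e → ∃ λ v → doneN e 0 ≡ suc v
  doneN-0 e rewrite fst-pair 0 (node e 0 0) = _ , refl

decisionE : Expr 2
decisionE = IFZ (EQ search₂E (lit 1)) (lit 2) (IFZ (EQ search₁E (lit 1)) (lit 1) (lit 0))

opaque
  decisionN : ℕ → ℕ → ℕ
  decisionN e t = ifz (eqN (search₂ e t) 1) 2 (ifz (eqN (search₁ e t) 1) 1 0)

  decisionC-sem : ∀ e t → sem (compile decisionE) [ e ⨾ t ] ≡ decisionN e t
  decisionC-sem e t = refl

data Decision (e t : ℕ) : Set where
  keep-both   : decisionN e t ≡ 0 → search₁ e t ≢ 1 → search₂ e t ≢ 1 → Decision e t
  keep-first  : decisionN e t ≡ 1 → search₁ e t ≡ 1 → Decision e t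
  keep-second : decisionN e t ≡ 2 → search₂ e t ≡ 1 → Decision e t

opaque
  unfolding decisionN
  decision : ∀ e t → Decision e t
  decision e t = by-cases (eqN (search₂ e t) 1) (eqN (search₁ e t) 1) refl refl refl
    where
      by-cases : ∀ a b → eqN (search₂ e t) 1 ≡ a → eqN (search₁ e t) 1 ≡ b →
                 decisionN e t ≡ ifz a 2 (ifz b 1 0) → Decision e t
      by-cases zero b eq₂ eq₁ d = keep-second d (eqN≡0⇒≡ _ _ eq₂)
      by-cases (suc v₂) zero eq₂ eq₁ d = keep-first d (eqN≡0⇒≡ _ _ eq₁)
      by-cases (suc v₂) (suc v₁) eq₂ eq₁ d = keep-both d (eqN≡suc⇒≢ _ _ v₁ eq₁) (eqN≡suc⇒≢ _ _ v₂ eq₂)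

decisionC : Computable 2
decisionC = withSem (compile decisionE) (λ { [ e ⨾ t ] → decisionN e t }) (λ { [ e ⨾ t ] → decisionC-sem e t })

actsE : Expr 2
actsE = IFZ x1 (lit 1) (IFZ (doneC $ [ x0 ⨾ x1 ]) (IFZ (doneC $ [ x0 ⨾ PRED x1 ]) (lit 1) (lit 0)) (lit 1))

-- e acts at stage t when t is the first stage at which both searches have settled.
opaque
  actsN : ℕ → ℕ → ℕ
  actsN e t = ifz t 1 (ifz (doneN e t) (ifz (doneN e (pred t)) 1 0) 1)

  actsC-sem : ∀ e t → sem (compile actsE) [ e ⨾ t ] ≡ actsN e t
  actsC-sem e t = refl

  acts-done : ∀ e t → actsN e t ≡ 0 → ∃ λ t₀ → t ≡ suc t₀ × doneN e t ≡ 0 × ∃ λ v → doneN e t₀ ≡ suc v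
  acts-done e zero ()
  acts-done e (suc t₀) acts with doneN e (suc t₀) | doneN e t₀ in unfin
  acts-done e (suc t₀) acts | zero | suc v = t₀ , refl , refl , v , unfin
  acts-done e (suc t₀) () | zero | zero
  acts-done e (suc t₀) () | suc _ | _

  done-acts : ∀ e t₀ v → doneN e (suc t₀) ≡ 0 → doneN e t₀ ≡ suc v → actsN e (suc t₀) ≡ 0
  done-acts e t₀ v fin unfin rewrite fin | unfin = refl

actsC : Computable 2
actsC = withSem (compile actsE) (λ { [ e ⨾ t ] → actsN e t }) (λ { [ e ⨾ t ] → actsC-sem e t })

acts-if-done : ∀ e T → doneN e T ≡ 0 → ∃ λ T' → actsN e T' ≡ 0
acts-if-done e zero fin = ⊥-elim (0≢1+n (trans (sym fin) (proj₂ (doneN-0 e))))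
acts-if-done e (suc T) fin with doneN e T in fin′
... | zero = acts-if-done e T fin′
... | suc v = suc T , done-acts e T v fin fin′

acts-unique : ∀ e t t' → actsN e t ≡ 0 → actsN e t' ≡ 0 → t ≡ t'
acts-unique e t t' acts acts' with acts-done e t acts | acts-done e t' acts'
... | t₀ , refl , fin , v , unfin | t₀' , refl , fin' , v' , unfin' with <-cmp t₀ t₀'
...   | tri≈ _ t₀≡t₀' _ = cong suc t₀≡t₀'
...   | tri< t₀<t₀' _ _ = ⊥-elim (0≢1+n (trans (sym (doneN-mono e (suc t₀) t₀' fin t₀<t₀')) unfin'))
...   | tri> _ _ t₀'<t₀ = ⊥-elim (0≢1+n (trans (sym (doneN-mono e (suc t₀') t₀ fin' t₀'<t₀)) unfin))

acts-not-before : ∀ e t u → actsN e t ≡ 0 → u < t → ∃ λ v → actsN e u ≡ suc v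
acts-not-before e t u acts u<t with actsN e u in acts-u
... | suc v = v , refl
... | zero = ⊥-elim (<-irrefl (acts-unique e u t acts-u acts) u<t)

acts-not-0 : ∀ e → ∃ λ v → actsN e 0 ≡ suc v
acts-not-0 e with actsN e 0 in acts
... | suc v = v , refl
... | zero = case proj₁ (proj₂ (acts-done e 0 acts)) of λ ()

keep-both-fixed : ∀ e T → actsN e T ≡ 0 → search₁ e T ≢ 1 → search₂ e T ≢ 1 → search₁ e T ≡ 2 × search₂ e T ≡ 2
keep-both-fixed e T acts missed₁ missed₂ =
  let (_ , _ , fin , _) = acts-done e T acts
      (settled₁ , settled₂) = doneN≡0⇒Settled e T fin
  in Settled-≢1 settled₁ missed₁ , Settled-≢1 settled₂ missed₂

-- The set A and its regressing function g

-- A is enumerated as 0 followed by consecutive blocks, block s = pairN e T consisting of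
--   node e 0 T, ..., node e 0 0, node e 1 T, ..., node e 1 0   if e acts at T and keeps both,
--   node e i T, ..., node e i 0                                 if e acts at T and keeps only i,
--   the filler pairN 1 s                                        otherwise.
-- g maps the first node of a block to the last node of the previous one (or to 0), and every
-- other node to the one before it; off A it sends node e i t up to node e i (suc t).

keptN : ℕ → ℕ → ℕ
keptN i d = ifz i (ifz (eqN d 2) 1 0) (ifz (eqN d 1) 1 0)

keptC : Computable 2
keptC = withSem (compile (IFZ x0 (IFZ (EQ x1 (lit 2)) (lit 1) (lit 0)) (IFZ (EQ x1 (lit 1)) (lit 1) (lit 0))))
                (λ { [ i ⨾ d ] → keptN i d }) (λ { [ i ⨾ d ] → refl })

filler : ℕ → ℕ
filler s = pairN 1 s

lastNode : ℕ → ℕ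
lastNode s = ifz (actsN (fstN s) (sndN s))
                 (node (fstN s) (ifz (eqN (decisionN (fstN s) (sndN s)) 1) 0 1) 0)
                 (filler s)

lastNodeC : Computable 1
lastNodeC = withSem
  (compile (IFZ (actsC $ [ FST x0 ⨾ SND x0 ])
                (nodeC $ [ FST x0 ⨾ IFZ (EQ (decisionC $ [ FST x0 ⨾ SND x0 ]) (lit 1)) (lit 0) (lit 1) ⨾ lit 0 ])
                (PAIR (lit 1) x0)))
  (λ { [ s ] → lastNode s }) (λ { [ s ] → refl })

lastBefore : ℕ → ℕ
lastBefore s = ifz s 0 (lastNode (pred s))

lastBeforeC : Computable 1
lastBeforeC = withSem (compile (IFZ x0 (lit 0) (lastNodeC $ [ PRED x0 ])))
                      (λ { [ s ] → lastBefore s }) (λ { [ s ] → refl })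

gNode : ℕ → ℕ → ℕ → ℕ
gNode i e t = ifz (actsN e t + keptN i (decisionN e t))
                  (ifz (eqN i 1 + decisionN e t) (node e 0 0) (lastBefore (pairN e t)))
                  (node e i (suc t))

gNodeC : Computable 3
gNodeC = withSem
  (compile (IFZ (app₂ addC (actsC $ [ x1 ⨾ x2 ]) (keptC $ [ x0 ⨾ decisionC $ [ x1 ⨾ x2 ] ]))
                (IFZ (app₂ addC (EQ x0 (lit 1)) (decisionC $ [ x1 ⨾ x2 ])) (nodeC $ [ x1 ⨾ lit 0 ⨾ lit 0 ])
                     (lastBeforeC $ [ PAIR x1 x2 ]))
                (nodeC $ [ x1 ⨾ x0 ⨾ SUC x2 ])))
  (λ { [ i ⨾ e ⨾ t ] → gNode i e t }) (λ { [ i ⨾ e ⨾ t ] → refl })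

g : ℕ → ℕ
g n = ifz (fstN n) 0 (ifz (pred (fstN n)) (lastBefore (sndN n)) (gNode (fstN n ∸ 2) (fstN (sndN n)) (sndN (sndN n))))

gC : Computable 1
gC = withSem
  (compile (IFZ (FST x0) (lit 0)
           (IFZ (PRED (FST x0)) (lastBeforeC $ [ SND x0 ])
                (gNodeC $ [ MINUS (FST x0) (lit 2) ⨾ FST (SND x0) ⨾ SND (SND x0) ]))))
  (λ { [ n ] → g n }) (λ { [ n ] → refl })

g-0 : g 0 ≡ 0
g-0 rewrite fst-0 = refl

g-filler : ∀ s → g (filler s) ≡ lastBefore s
g-filler s rewrite fst-pair 1 s | snd-pair 1 s = refl

g-node : ∀ e i t → g (node e i t) ≡ gNode i e t
g-node e i t
  rewrite fst-pair (suc (suc i)) (pairN e t) | snd-pair (suc (suc i)) (pairN e t) | fst-pair e t | snd-pair e t = refl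

gNode-idle : ∀ i e t v → actsN e t ≡ suc v → gNode i e t ≡ node e i (suc t)
gNode-idle i e t v idle rewrite idle = refl

gNode-acts : ∀ i e t w → actsN e t ≡ 0 → keptN i (decisionN e t) ≡ 0 → eqN i 1 + decisionN e t ≡ suc w →
             gNode i e t ≡ lastBefore (pairN e t)
gNode-acts i e t w acts kept not-both rewrite acts | kept | not-both = refl

gNode-both : ∀ e t → actsN e t ≡ 0 → decisionN e t ≡ 0 → gNode 1 e t ≡ node e 0 0
gNode-both e t acts both rewrite acts | both = refl

g-chain-step : ∀ e i t j → actsN e t ≡ 0 → j < t → g (node e i (t ∸ suc j)) ≡ node e i (t ∸ j)
g-chain-step e i t j acts j<t =
  let (v , idle) = acts-not-before e t (t ∸ suc j) acts (≤-trans (≤-reflexive t∸j≡) (m∸n≤m t j)) in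
  trans (g-node e i _) (trans (gNode-idle i e _ v idle) (cong (node e i) t∸j≡))
  where
    t∸j≡ : suc (t ∸ suc j) ≡ t ∸ j
    t∸j≡ = sym (+-∸-assoc 1 j<t)

blockLength : ℕ → ℕ
blockLength s = ifz (actsN (fstN s) (sndN s))
                    (ifz (decisionN (fstN s) (sndN s)) (suc (sndN s) + suc (sndN s)) (suc (sndN s)))
                    1

twoChains : ℕ → ℕ → ℕ → ℕ
twoChains e t j = ifz (suc j ∸ suc t) (node e 0 (t ∸ j)) (node e 1 (t ∸ (j ∸ suc t)))

blockNode : ℕ → ℕ → ℕ
blockNode s j = ifz (actsN (fstN s) (sndN s))
                    (ifz (decisionN (fstN s) (sndN s)) (twoChains (fstN s) (sndN s) j)
                         (node (fstN s) (pred (decisionN (fstN s) (sndN s))) (sndN s ∸ j)))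
                    (filler s)

data BlockView (s : ℕ) : Set where
  filler-block : ∀ v → actsN (fstN s) (sndN s) ≡ suc v → BlockView s
  one-chain    : ∀ i → i ≤ 1 → actsN (fstN s) (sndN s) ≡ 0 → decisionN (fstN s) (sndN s) ≡ suc i → BlockView s
  two-chains   : actsN (fstN s) (sndN s) ≡ 0 → decisionN (fstN s) (sndN s) ≡ 0 → BlockView s

blockView : ∀ s → BlockView s
blockView s with actsN (fstN s) (sndN s) in acts
... | suc v = filler-block v acts
... | zero with decision (fstN s) (sndN s)
...   | keep-both d _ _ = two-chains acts d
...   | keep-first d _ = one-chain 0 z≤n acts d
...   | keep-second d _ = one-chain 1 ≤-refl acts d

module _ (s : ℕ) where
  private
    e = fstN s
    T = sndN s

  blockLength-filler : ∀ v → actsN e T ≡ suc v → blockLength s ≡ 1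
  blockLength-filler v idle rewrite idle = refl

  blockNode-filler : ∀ v j → actsN e T ≡ suc v → blockNode s j ≡ filler s
  blockNode-filler v j idle rewrite idle = refl

  blockLength-one : ∀ i → actsN e T ≡ 0 → decisionN e T ≡ suc i → blockLength s ≡ suc T
  blockLength-one i acts d rewrite acts | d = refl

  blockNode-one : ∀ i j → actsN e T ≡ 0 → decisionN e T ≡ suc i → blockNode s j ≡ node e i (T ∸ j)
  blockNode-one i j acts d rewrite acts | d = refl

  blockLength-two : actsN e T ≡ 0 → decisionN e T ≡ 0 → blockLength s ≡ suc T + suc T
  blockLength-two acts d rewrite acts | d = refl

  blockNode-two : ∀ j → actsN e T ≡ 0 → decisionN e T ≡ 0 → blockNode s j ≡ twoChains e T j
  blockNode-two j acts d rewrite acts | d = refl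

twoChains-first : ∀ e t j → j ≤ t → twoChains e t j ≡ node e 0 (t ∸ j)
twoChains-first e t j j≤t rewrite m≤n⇒m∸n≡0 j≤t = refl

twoChains-second : ∀ e t j → t < j → twoChains e t j ≡ node e 1 (t ∸ (j ∸ suc t))
twoChains-second e t j t<j with positive (m<n⇒0<n∸m t<j)
... | _ , pos rewrite pos = refl

0<blockLength : ∀ s → 0 < blockLength s
0<blockLength s with blockView s
... | filler-block v idle rewrite blockLength-filler s v idle = s≤s z≤n
... | one-chain i _ acts d rewrite blockLength-one s i acts d = s≤s z≤n
... | two-chains acts d rewrite blockLength-two s acts d = s≤s z≤n

second-chain-index< : ∀ t j → t < j → j < t + suc t → j ∸ suc t < t
second-chain-index< t j t<j j<len =
  +-cancelˡ-< (suc t) _ _ (subst (_< suc t + t) (sym (m+[n∸m]≡n t<j)) (subst (j <_) (+-comm t (suc t)) j<len))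

g-within-twoChains : ∀ e t j → actsN e t ≡ 0 → decisionN e t ≡ 0 → suc j < suc t + suc t →
                     g (twoChains e t (suc j)) ≡ twoChains e t j
g-within-twoChains e t j acts both j<len with <-cmp (suc j) (suc t)
... | tri< sj≤st _ _ = begin
  g (twoChains e t (suc j))      ≡⟨ cong g (twoChains-first e t (suc j) j<t) ⟩
  g (node e 0 (t ∸ suc j))       ≡⟨ g-chain-step e 0 t j acts j<t ⟩
  node e 0 (t ∸ j)               ≡⟨ twoChains-first e t j (<⇒≤ j<t) ⟨
  twoChains e t j                ∎
  where
    open ≡-Reasoning
    j<t = ≤-pred sj≤st
... | tri≈ _ refl _ = begin
  g (twoChains e t (suc t))      ≡⟨ cong g (twoChains-second e t (suc t) ≤-refl) ⟩
  g (node e 1 (t ∸ (t ∸ t)))     ≡⟨ cong (λ z → g (node e 1 (t ∸ z))) (n∸n≡0 t) ⟩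
  g (node e 1 t)                 ≡⟨ g-node e 1 t ⟩
  gNode 1 e t                    ≡⟨ gNode-both e t acts both ⟩
  node e 0 0                     ≡⟨ cong (node e 0) (n∸n≡0 t) ⟨
  node e 0 (t ∸ t)               ≡⟨ twoChains-first e t t ≤-refl ⟨
  twoChains e t t                ∎
  where open ≡-Reasoning
... | tri> _ _ st<sj = begin
  g (twoChains e t (suc j))               ≡⟨ cong g (twoChains-second e t (suc j) (≤-trans (n≤1+n _) st<sj)) ⟩
  g (node e 1 (t ∸ (j ∸ t)))              ≡⟨ cong (λ z → g (node e 1 (t ∸ z))) (+-∸-assoc 1 t<j) ⟩
  g (node e 1 (t ∸ suc (j ∸ suc t)))      ≡⟨ g-chain-step e 1 t (j ∸ suc t) acts (second-chain-index< t j t<j (≤-pred j<len)) ⟩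
  node e 1 (t ∸ (j ∸ suc t))              ≡⟨ twoChains-second e t j t<j ⟨
  twoChains e t j                         ∎
  where
    open ≡-Reasoning
    t<j = ≤-pred st<sj

g-within-block : ∀ s j → suc j < blockLength s → g (blockNode s (suc j)) ≡ blockNode s j
g-within-block s j j<len with blockView s
... | filler-block v idle = case subst (suc j <_) (blockLength-filler s v idle) j<len of λ { (s≤s ()) }
... | one-chain i _ acts d =
  trans (cong g (blockNode-one s i (suc j) acts d))
   (trans (g-chain-step (fstN s) i (sndN s) j acts (≤-pred (subst (suc j <_) (blockLength-one s i acts d) j<len)))
          (sym (blockNode-one s i j acts d)))
... | two-chains acts d =
  trans (cong g (blockNode-two s (suc j) acts d))
   (trans (g-within-twoChains (fstN s) (sndN s) j acts d (subst (suc j <_) (blockLength-two s acts d) j<len))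
          (sym (blockNode-two s j acts d)))

g-block-start : ∀ s → g (blockNode (suc s) 0) ≡ lastNode s
g-block-start s with blockView (suc s)
... | filler-block v idle rewrite blockNode-filler (suc s) v 0 idle = g-filler (suc s)
... | one-chain zero _ acts d rewrite blockNode-one (suc s) 0 0 acts d =
  trans (g-node _ 0 _) (trans (gNode-acts 0 _ _ 1 acts (cong (keptN 0) d) (cong (eqN 0 1 +_) d))
                              (cong lastBefore (pair-fst-snd (suc s))))
... | one-chain (suc zero) _ acts d rewrite blockNode-one (suc s) 1 0 acts d =
  trans (g-node _ 1 _) (trans (gNode-acts 1 _ _ 1 acts (cong (keptN 1) d) (cong (eqN 1 1 +_) d))
                              (cong lastBefore (pair-fst-snd (suc s))))
... | one-chain (suc (suc _)) (s≤s ()) _ _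
... | two-chains acts d rewrite blockNode-two (suc s) 0 acts d | twoChains-first (fstN (suc s)) (sndN (suc s)) 0 z≤n =
  trans (g-node _ 0 _) (trans (gNode-acts 0 _ _ 0 acts (cong (keptN 0) d) (cong (eqN 0 1 +_) d))
                              (cong lastBefore (pair-fst-snd (suc s))))

lastNode-block-end : ∀ s → lastNode s ≡ blockNode s (pred (blockLength s))
lastNode-block-end s with blockView s
... | filler-block v idle rewrite blockLength-filler s v idle | blockNode-filler s v 0 idle | idle = refl
... | one-chain zero _ acts d
  rewrite blockLength-one s 0 acts d | blockNode-one s 0 (sndN s) acts d | acts | d | n∸n≡0 (sndN s) = refl
... | one-chain (suc zero) _ acts d
  rewrite blockLength-one s 1 acts d | blockNode-one s 1 (sndN s) acts d | acts | d | n∸n≡0 (sndN s) = refl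
... | one-chain (suc (suc _)) (s≤s ()) _ _
... | two-chains acts d
  rewrite blockLength-two s acts d | blockNode-two s (sndN s + suc (sndN s)) acts d
        | twoChains-second (fstN s) (sndN s) (sndN s + suc (sndN s)) (m<m+n (sndN s) (s≤s z≤n))
        | m+n∸n≡m (sndN s) (suc (sndN s)) | n∸n≡0 (sndN s) | acts | d = refl

Pos : Set
Pos = ℕ × ℕ

Valid : Pos → Set
Valid (s , j) = j < blockLength s

next : Pos → Pos
next (s , j) with suc j <? blockLength s
... | yes _ = s , suc j
... | no _ = suc s , 0

next-valid : ∀ p → Valid p → Valid (next p)
next-valid (s , j) _ with suc j <? blockLength s
... | yes j<len = j<len
... | no _ = 0<blockLength (suc s)

next-within : ∀ s j → suc j < blockLength s → next (s , j) ≡ (s , suc j)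
next-within s j j<len with suc j <? blockLength s
... | yes _ = refl
... | no j≮len = ⊥-elim (j≮len j<len)

next-across : ∀ s j → ¬ (suc j < blockLength s) → next (s , j) ≡ (suc s , 0)
next-across s j j≮len with suc j <? blockLength s
... | yes j<len = ⊥-elim (j≮len j<len)
... | no _ = refl

pos : ℕ → Pos
pos zero = 0 , 0
pos (suc n) = next (pos n)

pos-valid : ∀ n → Valid (pos n)
pos-valid zero = 0<blockLength 0
pos-valid (suc n) = next-valid (pos n) (pos-valid n)

blockNodeAt : Pos → ℕ
blockNodeAt (s , j) = blockNode s j

enum : ℕ → ℕ
enum zero = 0
enum (suc n) = blockNodeAt (pos n)

A : ℕ → Set
A x = ∃ λ n → enum n ≡ x

g-next : ∀ p → Valid p → g (blockNodeAt (next p)) ≡ blockNodeAt p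
g-next (s , j) j<len with suc j <? blockLength s
... | yes sj<len = g-within-block s j sj<len
... | no sj≮len = trans (g-block-start s) (trans (lastNode-block-end s) (cong (blockNode s) (cong pred (sym last))))
  where
    last : suc j ≡ blockLength s
    last = ≤-antisym j<len (≮⇒≥ sj≮len)

g-enum : ∀ n → g (enum (suc n)) ≡ enum n
g-enum zero with acts-not-0 (fstN 0)
... | v , idle = trans (cong g (blockNode-filler 0 v 0 (subst (λ t → actsN (fstN 0) t ≡ suc v) (sym snd-0) idle)))
                       (g-filler 0)
g-enum (suc n) = g-next (pos n) (pos-valid n)

blockStart : ℕ → ℕ
blockStart zero = 0
blockStart (suc s) = blockStart s + blockLength s

index : Pos → ℕ
index (s , j) = blockStart s + j

index-next : ∀ p → Valid p → index (next p) ≡ suc (index p)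
index-next (s , j) j<len with suc j <? blockLength s
... | yes _ = +-suc (blockStart s) j
... | no sj≮len = trans (+-identityʳ _) (trans (cong (blockStart s +_) (sym last)) (+-suc (blockStart s) j))
  where
    last : suc j ≡ blockLength s
    last = ≤-antisym j<len (≮⇒≥ sj≮len)

index-pos : ∀ n → index (pos n) ≡ n
index-pos zero = refl
index-pos (suc n) = trans (index-next (pos n) (pos-valid n)) (cong suc (index-pos n))

pos-surjective : ∀ s j → j < blockLength s → ∃ λ n → pos n ≡ (s , j)
pos-surjective zero zero _ = 0 , refl
pos-surjective s (suc j) sj<len =
  let (n , eq) = pos-surjective s j (<-trans (n<1+n j) sj<len) in
  suc n , trans (cong next eq) (next-within s j sj<len)
pos-surjective (suc s) zero _ with positive (0<blockLength s)
... | b , len≡ =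
  let (n , eq) = pos-surjective s b (subst (b <_) (sym len≡) ≤-refl) in
  suc n , trans (cong next eq) (next-across s b (<-irrefl (sym len≡)))

blockNode∈A : ∀ s j → j < blockLength s → A (blockNode s j)
blockNode∈A s j j<len = let (n , eq) = pos-surjective s j j<len in suc n , cong blockNodeAt eq

filler≢node : ∀ {s e i u} → filler s ≢ node e i u
filler≢node eq = case proj₁ (pair-injective eq) of λ ()

0≢node : ∀ {e i u} → 0 ≢ node e i u
0≢node eq = case trans (sym fst-0) (trans (cong fstN eq) (fst-pair _ _)) of λ ()

0≢filler : ∀ {s} → 0 ≢ filler s
0≢filler eq = case trans (sym fst-0) (trans (cong fstN eq) (fst-pair 1 _)) of λ ()

data NodeShape (s j : ℕ) : Set where
  is-filler : blockNode s j ≡ filler s → j ≡ 0 → NodeShape s j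
  is-node   : ∀ i u → blockNode s j ≡ node (fstN s) i u → actsN (fstN s) (sndN s) ≡ 0 →
              keptN i (decisionN (fstN s) (sndN s)) ≡ 0 → NodeShape s j

nodeShape : ∀ s j → j < blockLength s → NodeShape s j
nodeShape s j j<len with blockView s
... | filler-block v idle = is-filler (blockNode-filler s v j idle) (n<1⇒n≡0 (subst (j <_) (blockLength-filler s v idle) j<len))
... | one-chain zero _ acts d = is-node 0 _ (blockNode-one s 0 j acts d) acts (cong (keptN 0) d)
... | one-chain (suc zero) _ acts d = is-node 1 _ (blockNode-one s 1 j acts d) acts (cong (keptN 1) d)
... | one-chain (suc (suc _)) (s≤s ()) _ _
... | two-chains acts d with j ≤? sndN s
...   | yes j≤T = is-node 0 _ (trans (blockNode-two s j acts d) (twoChains-first _ _ j j≤T)) acts (cong (keptN 0) d)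
...   | no j≰T = is-node 1 _ (trans (blockNode-two s j acts d) (twoChains-second _ _ j (≰⇒> j≰T))) acts (cong (keptN 1) d)

twoChains-injective : ∀ e t j j' → j < suc t + suc t → j' < suc t + suc t →
                      twoChains e t j ≡ twoChains e t j' → j ≡ j'
twoChains-injective e t j j' j<len j'<len eq = by-chain (j ≤? t) (j' ≤? t)
  where
    same : ∀ {i u i' u'} → twoChains e t j ≡ node e i u → twoChains e t j' ≡ node e i' u' → i ≡ i' × u ≡ u'
    same p q = proj₂ (node-injective (trans (sym p) (trans eq q)))
    second-index≤ : ∀ {k} → k < suc t + suc t → k ∸ suc t ≤ t
    second-index≤ k<len = ≤-trans (∸-monoˡ-≤ (suc t) (≤-pred k<len)) (≤-reflexive (m+n∸n≡m t (suc t)))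
    by-chain : Dec (j ≤ t) → Dec (j' ≤ t) → j ≡ j'
    by-chain (yes j≤t) (yes j'≤t) =
      ∸-cancelˡ-≡ j≤t j'≤t (proj₂ (same (twoChains-first e t j j≤t) (twoChains-first e t j' j'≤t)))
    by-chain (yes j≤t) (no j'≰t) =
      case proj₁ (same (twoChains-first e t j j≤t) (twoChains-second e t j' (≰⇒> j'≰t))) of λ ()
    by-chain (no j≰t) (yes j'≤t) =
      case proj₁ (same (twoChains-second e t j (≰⇒> j≰t)) (twoChains-first e t j' j'≤t)) of λ ()
    by-chain (no j≰t) (no j'≰t) =
      ∸-cancelʳ-≡ (≰⇒> j≰t) (≰⇒> j'≰t)
        (∸-cancelˡ-≡ (second-index≤ j<len) (second-index≤ j'<len)
          (proj₂ (same (twoChains-second e t j (≰⇒> j≰t)) (twoChains-second e t j' (≰⇒> j'≰t)))))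

blockNode-injectiveʳ : ∀ s j j' → j < blockLength s → j' < blockLength s → blockNode s j ≡ blockNode s j' → j ≡ j'
blockNode-injectiveʳ s j j' j<len j'<len eq with blockView s
... | filler-block v idle = trans (n<1⇒n≡0 (subst (j <_) len≡1 j<len)) (sym (n<1⇒n≡0 (subst (j' <_) len≡1 j'<len)))
  where len≡1 = blockLength-filler s v idle
... | one-chain i _ acts d =
  ∸-cancelˡ-≡ (≤-pred (subst (j <_) len≡ j<len)) (≤-pred (subst (j' <_) len≡ j'<len))
    (proj₂ (proj₂ (node-injective (trans (sym (blockNode-one s i j acts d)) (trans eq (blockNode-one s i j' acts d))))))
  where len≡ = blockLength-one s i acts d
... | two-chains acts d =
  twoChains-injective (fstN s) (sndN s) j j' (subst (j <_) len≡ j<len) (subst (j' <_) len≡ j'<len)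
    (trans (sym (blockNode-two s j acts d)) (trans eq (blockNode-two s j' acts d)))
  where len≡ = blockLength-two s acts d

-- Distinct blocks are disjoint: fillers name their block, and a node of e lies in the block of
-- the unique stage at which e acts.
blockNode-injective : ∀ s j s' j' → j < blockLength s → j' < blockLength s' → blockNode s j ≡ blockNode s' j' →
                      s ≡ s' × j ≡ j'
blockNode-injective s j s' j' j<len j'<len eq with nodeShape s j j<len | nodeShape s' j' j'<len
... | is-filler f j≡0 | is-filler f' j'≡0 = proj₂ (pair-injective (trans (sym f) (trans eq f'))) , trans j≡0 (sym j'≡0)
... | is-filler f _ | is-node _ _ n _ _ = ⊥-elim (filler≢node (trans (sym f) (trans eq n)))
... | is-node _ _ n _ _ | is-filler f _ = ⊥-elim (filler≢node (trans (sym f) (trans (sym eq) n)))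
... | is-node i u n acts _ | is-node i' u' n' acts' _ =
  s≡s' , blockNode-injectiveʳ s j j' j<len (subst (λ z → j' < blockLength z) (sym s≡s') j'<len)
                              (trans eq (cong (λ z → blockNode z j') (sym s≡s')))
  where
    e≡e' : fstN s ≡ fstN s'
    e≡e' = proj₁ (node-injective (trans (sym n) (trans eq n')))
    T≡T' : sndN s ≡ sndN s'
    T≡T' = acts-unique (fstN s) (sndN s) (sndN s') acts (subst (λ z → actsN z (sndN s') ≡ 0) (sym e≡e') acts')
    s≡s' : s ≡ s'
    s≡s' = trans (sym (pair-fst-snd s)) (trans (cong₂ pairN e≡e' T≡T') (pair-fst-snd s'))

0≢blockNode : ∀ s j → j < blockLength s → 0 ≢ blockNode s j
0≢blockNode s j j<len eq with nodeShape s j j<len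
... | is-filler f _ = 0≢filler (trans eq f)
... | is-node _ _ n _ _ = 0≢node (trans eq n)

enum-injective : ∀ m n → enum m ≡ enum n → m ≡ n
enum-injective zero zero _ = refl
enum-injective zero (suc n) eq = ⊥-elim (0≢blockNode _ _ (pos-valid n) eq)
enum-injective (suc m) zero eq = ⊥-elim (0≢blockNode _ _ (pos-valid m) (sym eq))
enum-injective (suc m) (suc n) eq =
  let (s≡s' , j≡j') = blockNode-injective _ _ _ _ (pos-valid m) (pos-valid n) eq in
  cong suc (trans (sym (index-pos m)) (trans (cong₂ (λ s j → blockStart s + j) s≡s' j≡j') (index-pos n)))

one-chain-end∈A : ∀ s i → actsN (fstN s) (sndN s) ≡ 0 → decisionN (fstN s) (sndN s) ≡ suc i → A (node (fstN s) i 0)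
one-chain-end∈A s i acts d =
  subst A (trans (blockNode-one s i _ acts d) (cong (node _ i) (n∸n≡0 (sndN s))))
          (blockNode∈A s (sndN s) (subst (sndN s <_) (sym (blockLength-one s i acts d)) ≤-refl))

two-chains-ends∈A : ∀ s → actsN (fstN s) (sndN s) ≡ 0 → decisionN (fstN s) (sndN s) ≡ 0 →
                    A (node (fstN s) 0 0) × A (node (fstN s) 1 0)
two-chains-ends∈A s acts d =
  subst A (trans (blockNode-two s T acts d) (trans (twoChains-first _ _ T ≤-refl) (cong (node _ 0) (n∸n≡0 T))))
          (blockNode∈A s T (subst (T <_) (sym len≡) (≤-trans (n<1+n T) (m≤m+n (suc T) (suc T))))) ,
  subst A (trans (blockNode-two s _ acts d)
            (trans (twoChains-second _ _ _ (m<m+n T (s≤s z≤n)))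
                   (trans (cong (λ z → node (fstN s) 1 (T ∸ z)) (m+n∸n≡m T (suc T))) (cong (node _ 1) (n∸n≡0 T)))))
          (blockNode∈A s (T + suc T) (subst (T + suc T <_) (sym len≡) ≤-refl))
  where
    T = sndN s
    len≡ = blockLength-two s acts d

kept-node∈A′ : ∀ s i → i ≤ 1 → actsN (fstN s) (sndN s) ≡ 0 → keptN i (decisionN (fstN s) (sndN s)) ≡ 0 →
               A (node (fstN s) i 0)
kept-node∈A′ s i i≤1 acts kept with decision (fstN s) (sndN s)
kept-node∈A′ s zero _ acts kept | keep-both d _ _ = proj₁ (two-chains-ends∈A s acts d)
kept-node∈A′ s (suc zero) _ acts kept | keep-both d _ _ = proj₂ (two-chains-ends∈A s acts d)
kept-node∈A′ s zero _ acts kept | keep-first d _ = one-chain-end∈A s 0 acts d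
kept-node∈A′ s (suc zero) _ acts kept | keep-second d _ = one-chain-end∈A s 1 acts d
kept-node∈A′ s (suc zero) _ acts kept | keep-first d _ = case trans (sym kept) (cong (keptN 1) d) of λ ()
kept-node∈A′ s zero _ acts kept | keep-second d _ = case trans (sym kept) (cong (keptN 0) d) of λ ()
kept-node∈A′ s (suc (suc _)) (s≤s ()) acts kept | _

kept-node∈A : ∀ e T i → i ≤ 1 → actsN e T ≡ 0 → keptN i (decisionN e T) ≡ 0 → A (node e i 0)
kept-node∈A e T i i≤1 acts kept =
  subst (λ e → A (node e i 0)) (fst-pair e T)
    (kept-node∈A′ (pairN e T) i i≤1 (subst₂ (λ e T → actsN e T ≡ 0) e≡ T≡ acts)
                                    (subst₂ (λ e T → keptN i (decisionN e T) ≡ 0) e≡ T≡ kept))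
  where
    e≡ = sym (fst-pair e T)
    T≡ = sym (snd-pair e T)

dropped-node∉A : ∀ e T i v → actsN e T ≡ 0 → keptN i (decisionN e T) ≡ suc v → ¬ A (node e i 0)
dropped-node∉A e T i v acts dropped (zero , eq) = 0≢node eq
dropped-node∉A e T i v acts dropped (suc n , eq) with nodeShape _ _ (pos-valid n)
... | is-filler f _ = filler≢node (trans (sym f) eq)
... | is-node i' u n′ acts' kept' = 0≢1+n (trans (sym kept) dropped)
  where
    s = proj₁ (pos n)
    same = node-injective (trans (sym n′) eq)
    T≡ : sndN s ≡ T
    T≡ = acts-unique e (sndN s) T (subst (λ z → actsN z (sndN s) ≡ 0) (proj₁ same) acts') acts
    kept : keptN i (decisionN e T) ≡ 0
    kept = subst₂ (λ i e → keptN i (decisionN e T) ≡ 0) (proj₁ (proj₂ same)) (proj₁ same)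
                  (subst (λ t → keptN i' (decisionN (fstN s) t) ≡ 0) T≡ kept')

module OrbitSearch (φ : PR 1) (total : Total φ) where

  F : ℕ → ℕ
  F x = proj₁ (total x)

  F-evals : ∀ x → φ ⟨ x ⟩≡ F x
  F-evals x = proj₂ (total x)

  F^ : ℕ → ℕ → ℕ
  F^ zero x = x
  F^ (suc k) x = F (F^ k x)

  F^-suc : ∀ n x → F^ (suc n) x ≡ F^ n (F x)
  F^-suc zero x = refl
  F^-suc (suc n) x = cong F (F^-suc n x)

  F^-+ : ∀ k n x → F^ (k + n) x ≡ F^ k (F^ n x)
  F^-+ zero n x = refl
  F^-+ (suc k) n x = cong F (F^-+ k n x)

  Iter⇒F^ : ∀ {n x y} → Iter φ n x y → F^ n x ≡ y
  Iter⇒F^ it0 = refl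
  Iter⇒F^ {suc n} {x} (itS φx≡z it) =
    trans (F^-suc n x) (trans (cong (F^ n) (eval-functional (F-evals x) φx≡z)) (Iter⇒F^ it))

  -- Soundness of U for codes of total functions follows from completeness and monotonicity.
  U-sound : ∀ c t v → U ⌜ φ ⌝ c t ≡ suc v → v ≡ F c
  U-sound c t v halted =
    let (t₀ , halted₀) = U-complete (F-evals c) in
    suc-injective (trans (sym (U-mono ⌜ φ ⌝ c t (t ⊔ t₀) v halted (m≤m⊔n t t₀)))
                         (U-mono ⌜ φ ⌝ c t₀ (t ⊔ t₀) (F c) halted₀ (m≤n⊔m t t₀)))

  data MoveCase (y t c : ℕ) : ℕ → Set where
    move-found : c ≡ y → MoveCase y t c (pairN 1 0)
    move-out   : c ≢ y → U ⌜ φ ⌝ c t ≡ 0 → MoveCase y t c (pairN 3 0)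
    move-fixed : c ≢ y → F c ≡ c → MoveCase y t c (pairN 2 0)
    move-on    : c ≢ y → F c ≢ c → MoveCase y t c (pairN 0 (F c))

  moveCase : ∀ y t c → MoveCase y t c (orbitMove ⌜ φ ⌝ y t c)
  moveCase y t c with eqN c y in c=y
  ... | zero = move-found (eqN≡0⇒≡ c y c=y)
  ... | suc w with U ⌜ φ ⌝ c t in halted
  ...   | zero = move-out (eqN≡suc⇒≢ c y w c=y) halted
  ...   | suc v with eqN v c in v=c
  ...     | zero = move-fixed (eqN≡suc⇒≢ c y w c=y) (trans (sym (U-sound c t v halted)) (eqN≡0⇒≡ v c v=c))
  ...     | suc w′ = subst (λ z → MoveCase y t c (pairN 0 z)) (sym (U-sound c t v halted))
                           (move-on (eqN≡suc⇒≢ c y w c=y) (λ Fc≡c → eqN≡suc⇒≢ v c w′ v=c (trans (U-sound c t v halted) Fc≡c)))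

  data SearchState (x y t k : ℕ) : Set where
    searching         : orbitRun ⌜ φ ⌝ y t k (pairN 0 x) ≡ pairN 0 (F^ k x) →
                        (∀ i → i < k → F^ i x ≢ y × F (F^ i x) ≢ F^ i x) → SearchState x y t k
    found-target      : fstN (orbitRun ⌜ φ ⌝ y t k (pairN 0 x)) ≡ 1 →
                        (∃ λ j → F^ j x ≡ y) → SearchState x y t k
    found-fixed-point : fstN (orbitRun ⌜ φ ⌝ y t k (pairN 0 x)) ≡ 2 →
                        (∃ λ j → (∀ i → i ≤ j → F^ i x ≢ y) × F (F^ j x) ≡ F^ j x) → SearchState x y t k
    out-of-fuel       : fstN (orbitRun ⌜ φ ⌝ y t k (pairN 0 x)) ≡ 3 →
                        (∃ λ i → U ⌜ φ ⌝ (F^ i x) t ≡ 0) → SearchState x y t k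

  searchState : ∀ x y t k → SearchState x y t k
  searchState x y t zero = searching refl (λ i ())
  searchState x y t (suc k) with searchState x y t k
  ... | found-target r w = found-target (orbitRun-stopped ⌜ φ ⌝ y t k _ 0 r) w
  ... | found-fixed-point r w = found-fixed-point (orbitRun-stopped ⌜ φ ⌝ y t k _ 1 r) w
  ... | out-of-fuel r w = out-of-fuel (orbitRun-stopped ⌜ φ ⌝ y t k _ 2 r) w
  ... | searching at history with orbitMove ⌜ φ ⌝ y t (F^ k x) in moved | moveCase y t (F^ k x)
  ...   | _ | move-found x≡y = found-target (orbitRun-stops ⌜ φ ⌝ y t k _ _ 1 at moved) (k , x≡y)
  ...   | _ | move-out _ u≡0 = out-of-fuel (orbitRun-stops ⌜ φ ⌝ y t k _ _ 3 at moved) (k , u≡0)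
  ...   | _ | move-fixed x≢y fx = found-fixed-point (orbitRun-stops ⌜ φ ⌝ y t k _ _ 2 at moved) (k , history′ , fx)
    where
      history′ : ∀ i → i ≤ k → F^ i x ≢ y
      history′ i i≤k with m≤n⇒m<n∨m≡n i≤k
      ... | inj₁ i<k = proj₁ (history i i<k)
      ... | inj₂ refl = x≢y
  ...   | _ | move-on x≢y not-fixed = searching (orbitRun-moves ⌜ φ ⌝ y t k _ _ at moved) history′
    where
      history′ : ∀ i → i < suc k → F^ i x ≢ y × F (F^ i x) ≢ F^ i x
      history′ i (s≤s i≤k) with m≤n⇒m<n∨m≡n i≤k
      ... | inj₁ i<k = history i i<k
      ... | inj₂ refl = x≢y , not-fixed

  searchResult : ∀ {x y t r} → fstN (orbitRun ⌜ φ ⌝ y t t (pairN 0 x)) ≡ r → orbitSearch ⌜ φ ⌝ x y t ≡ r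
  searchResult {x} {y} {t} tag = trans (orbitSearch-def ⌜ φ ⌝ x y t) tag

  search-found : ∀ x y t → orbitSearch ⌜ φ ⌝ x y t ≡ 1 → ∃ λ j → F^ j x ≡ y
  search-found x y t r with searchState x y t t
  ... | found-target _ w = w
  ... | searching at _ = case trans (sym r) (searchResult (trans (cong fstN at) (fst-pair 0 _))) of λ ()
  ... | found-fixed-point tag _ = case trans (sym r) (searchResult tag) of λ ()
  ... | out-of-fuel tag _ = case trans (sym r) (searchResult tag) of λ ()

  search-fixed : ∀ x y t → orbitSearch ⌜ φ ⌝ x y t ≡ 2 →
                 ∃ λ j → (∀ i → i ≤ j → F^ i x ≢ y) × F (F^ j x) ≡ F^ j x
  search-fixed x y t r with searchState x y t t
  ... | found-fixed-point _ w = w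
  ... | searching at _ = case trans (sym r) (searchResult (trans (cong fstN at) (fst-pair 0 _))) of λ ()
  ... | found-target tag _ = case trans (sym r) (searchResult tag) of λ ()
  ... | out-of-fuel tag _ = case trans (sym r) (searchResult tag) of λ ()

  F^-stuck : ∀ n x → F (F^ n x) ≡ F^ n x → ∀ k → F^ (k + n) x ≡ F^ n x
  F^-stuck n x stationary zero = refl
  F^-stuck n x stationary (suc k) = trans (cong F (F^-stuck n x stationary k)) stationary

  fuel : ℕ → ℕ → ℕ
  fuel x i = proj₁ (U-complete (F-evals (F^ i x)))

  maxFuel : ℕ → ℕ → ℕ
  maxFuel x zero = fuel x 0
  maxFuel x (suc n) = maxFuel x n ⊔ fuel x (suc n)

  fuel≤maxFuel : ∀ x n i → i ≤ n → fuel x i ≤ maxFuel x n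
  fuel≤maxFuel x zero .zero z≤n = ≤-refl
  fuel≤maxFuel x (suc n) i i≤n with m≤n⇒m<n∨m≡n i≤n
  ... | inj₁ (s≤s i≤n′) = ≤-trans (fuel≤maxFuel x n i i≤n′) (m≤m⊔n _ _)
  ... | inj₂ refl = m≤n⊔m _ _

  -- With fuel beyond the point where the orbit becomes stationary, the search cannot run out
  -- of fuel, nor keep searching, so it settles.
  search-settles : ∀ x y n → F (F^ n x) ≡ F^ n x → ∃ λ t → Settled (orbitSearch ⌜ φ ⌝ x y t)
  search-settles x y n stationary = t , settled (searchState x y t t)
    where
      t = suc n ⊔ maxFuel x n
      halts-below : ∀ i → i ≤ n → ∃ λ v → U ⌜ φ ⌝ (F^ i x) t ≡ suc v
      halts-below i i≤n = _ , U-mono ⌜ φ ⌝ _ _ t _ (proj₂ (U-complete (F-evals (F^ i x))))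
                                     (≤-trans (fuel≤maxFuel x n i i≤n) (m≤n⊔m _ _))
      halts : ∀ i → ∃ λ v → U ⌜ φ ⌝ (F^ i x) t ≡ suc v
      halts i with i ≤? n
      ... | yes i≤n = halts-below i i≤n
      ... | no i≰n = subst (λ c → ∃ λ v → U ⌜ φ ⌝ c t ≡ suc v) (sym F^ix≡F^nx) (halts-below n ≤-refl)
        where
          F^ix≡F^nx : F^ i x ≡ F^ n x
          F^ix≡F^nx = trans (cong (λ k → F^ k x) (sym (m∸n+n≡m (<⇒≤ (≰⇒> i≰n))))) (F^-stuck n x stationary (i ∸ n))
      settled : SearchState x y t t → Settled (orbitSearch ⌜ φ ⌝ x y t)
      settled (searching _ history) = ⊥-elim (proj₂ (history n (m≤m⊔n (suc n) (maxFuel x n))) stationary)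
      settled (found-target tag _) = inj₁ (searchResult tag)
      settled (found-fixed-point tag _) = inj₂ (searchResult tag)
      settled (out-of-fuel _ (i , u≡0)) = ⊥-elim (0≢1+n (trans (sym u≡0) (proj₂ (halts i))))

-- No total special regressing function for A

module NoTotalSpecial (φ : PR 1) (a : ℕ → ℕ) (regressing : RegressingFor φ A a)
                      (total : Total φ) (special : Special φ a) where

  open OrbitSearch φ total

  e : ℕ
  e = ⌜ φ ⌝

  a-injective : ∀ m n → a m ≡ a n → m ≡ n
  a-injective = proj₁ (proj₁ regressing)

  A⇒a : ∀ {x} → A x → ∃ λ m → a m ≡ x
  A⇒a {x} = proj₁ (proj₂ (proj₁ regressing) x)

  a∈A : ∀ m → A (a m)
  a∈A m = proj₂ (proj₂ (proj₁ regressing) (a m)) (m , refl)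

  F-a : ∀ m → F (a m) ≡ a (pred m)
  F-a zero = eval-functional (F-evals _) (proj₂ (proj₂ regressing))
  F-a (suc m) = eval-functional (F-evals _) (proj₁ (proj₂ regressing) m)

  F^-a : ∀ k m → F^ k (a m) ≡ a (m ∸ k)
  F^-a zero m = refl
  F^-a (suc k) m = trans (cong F (F^-a k m)) (trans (F-a (m ∸ k)) (cong a (pred[m∸n]≡m∸[1+n] m k)))

  A-closed : ∀ k {x} → A x → A (F^ k x)
  A-closed k x∈A with A⇒a x∈A
  ... | m , refl = subst A (sym (F^-a k m)) (a∈A (m ∸ k))

  fixed-point-is-a₀ : ∀ m → F (a m) ≡ a m → m ≡ 0
  fixed-point-is-a₀ zero _ = refl
  fixed-point-is-a₀ (suc m) fixed = ⊥-elim (1+n≢n (sym (a-injective m (suc m) (trans (sym (F-a (suc m))) fixed))))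

  -- Along the orbit a m, a (m ∸ 1), ..., a 0 the only fixed point is a 0, which comes after
  -- every a m' with m' ≤ m.
  no-fixed-point-before : ∀ {m m' x y} → a m ≡ x → a m' ≡ y → m' ≤ m →
                          ∀ j → (∀ i → i ≤ j → F^ i x ≢ y) → F (F^ j x) ≢ F^ j x
  no-fixed-point-before {m} {m'} refl refl m'≤m j misses fixed with (m ∸ m') ≤? j
  ... | yes m∸m'≤j = misses (m ∸ m') m∸m'≤j (trans (F^-a (m ∸ m') m) (cong a (m∸[m∸n]≡n m'≤m)))
  ... | no m∸m'≰j = <-irrefl refl (≤-trans (≰⇒> m∸m'≰j) (≤-trans (m∸n≤m m m') m≤j))
    where
      m≤j : m ≤ j
      m≤j = m∸n≡0⇒m≤n (fixed-point-is-a₀ (m ∸ j) (subst (λ x → F x ≡ x) (F^-a j m) fixed))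

  reaches-fixed-point : ∀ x → ∃ λ n → F (F^ n x) ≡ F^ n x
  reaches-fixed-point x =
    let (n , it) = special x (F x , F-evals x) in
    n , trans (cong F (Iter⇒F^ it)) (trans (F-a 0) (sym (Iter⇒F^ it)))

  w₁ w₂ : ℕ
  w₁ = node e 0 0
  w₂ = node e 1 0

  acts-eventually : ∃ λ T → actsN e T ≡ 0
  acts-eventually =
    let (n₁ , fixed₁) = reaches-fixed-point w₁
        (n₂ , fixed₂) = reaches-fixed-point w₂
        (t₁ , settled₁) = search-settles w₁ w₂ n₁ fixed₁
        (t₂ , settled₂) = search-settles w₂ w₁ n₂ fixed₂
    in acts-if-done e (t₁ ⊔ t₂) (Settled⇒doneN≡0 e (t₁ ⊔ t₂) (Settled-mono e w₁ w₂ t₁ _ settled₁ (m≤m⊔n t₁ t₂))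
                                                            (Settled-mono e w₂ w₁ t₂ _ settled₂ (m≤n⊔m t₁ t₂)))

  contradiction : ⊥
  contradiction with acts-eventually
  ... | T , acts with decision e T
  ... | keep-second d found₂ =
    let (j , reaches) = search-found w₂ w₁ T found₂ in
    dropped-node∉A e T 0 0 acts (cong (keptN 0) d)
      (subst A reaches (A-closed j (kept-node∈A e T 1 ≤-refl acts (cong (keptN 1) d))))
  ... | keep-first d found₁ =
    let (j , reaches) = search-found w₁ w₂ T found₁ in
    dropped-node∉A e T 1 0 acts (cong (keptN 1) d)
      (subst A reaches (A-closed j (kept-node∈A e T 0 z≤n acts (cong (keptN 0) d))))
  ... | keep-both d missed₁ missed₂ with A⇒a (kept-node∈A e T 0 z≤n acts (cong (keptN 0) d))
                                      | A⇒a (kept-node∈A e T 1 ≤-refl acts (cong (keptN 1) d))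
                                      | keep-both-fixed e T acts missed₁ missed₂
  ...   | m₁ , a≡w₁ | m₂ , a≡w₂ | fixed₁ , fixed₂ with ≤-total m₁ m₂
  ...     | inj₁ m₁≤m₂ = let (j , misses , fixed) = search-fixed w₂ w₁ T fixed₂ in
                         no-fixed-point-before a≡w₂ a≡w₁ m₁≤m₂ j misses fixed
  ...     | inj₂ m₂≤m₁ = let (j , misses , fixed) = search-fixed w₁ w₂ T fixed₁ in
                         no-fixed-point-before a≡w₁ a≡w₂ m₂≤m₁ j misses fixed

g-regressing : RegressingFor (code gC) A enum
g-regressing = (enum-injective , λ x → (λ x∈A → x∈A) , (λ x∈A → x∈A)) ,
               (λ n → subst (code gC ⟨ enum (suc n) ⟩≡_) (g-enum n) (evals gC [ enum (suc n) ])) ,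
               subst (code gC ⟨ 0 ⟩≡_) g-0 (evals gC [ 0 ])

g-total : Total (code gC)
g-total x = g x , evals gC [ x ]

proposition3p10 : Σ (ℕ → Set) λ A →
    Regressive A ×
    (Σ (PR 1) λ φ → Total φ × Σ (ℕ → ℕ) λ a → RegressingFor φ A a) ×
    ¬ (Σ (PR 1) λ φ → Σ (ℕ → ℕ) λ a → RegressingFor φ A a × Total φ × Special φ a)
proposition3p10 =
  A , (code gC , enum , g-regressing) , (code gC , g-total , enum , g-regressing) ,
  λ (φ , a , regressing , total , special) → NoTotalSpecial.contradiction φ a regressing total special
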